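{- For nonnegative integers $m,n$ let $H_{m,n}(w)=\sum_{k=0}^{\min(m,n)}\binom mk\binom nk k!\,w^k$. Then, as formal power series, \begin{align*} \sum_{m,n\ge0}H_{2m,n}(u)\frac{x^m}{m!}\frac{y^n}{n!}&=e^{x+y+2uxy+u^2xy^2},\\ \sum_{m,n\ge0}H_{2m,2n}(u)\frac{x^m}{m!}\frac{y^n}{n!}&=\frac{1}{\sqrt{1-4u^2xy}}\exp\!\left(\frac{x+y+4uxy}{1-4u^2xy}\right),\\ \sum_{m\ge0}H_{m,m}(u)\frac{x^m}{m!}&=\frac{1}{1-ux}\exp\!\left(\frac{x}{1-ux}\right). \end{align*} -}

module Defs where

open import Data.Bool using (if_then_else_)
open import Data.Nat as ℕ using (ℕ; zero; suc; _⊓_; _≤ᵇ_; _!; _∸_)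
open import Data.Nat.Combinatorics using (_C_)
open import Data.Nat.Properties using (_!≢0)
open import Data.Integer using (+_)
open import Data.Rational using (ℚ; 0ℚ; 1ℚ; _+_; _*_; _-_; -_; _/_)
open import Relation.Binary.PropositionalEquality using (_≡_)

sumTo : ℕ → (ℕ → ℚ) → ℚ
sumTo zero    f = f 0
sumTo (suc n) f = sumTo n f + f (suc n)

prodBelow : ℕ → (ℕ → ℚ) → ℚ
prodBelow zero    f = 1ℚ
prodBelow (suc n) f = prodBelow n f * f n

ℕtoℚ : ℕ → ℚ
ℕtoℚ n = (+ n) / 1

inv! : ℕ → ℚ
inv! j = (+ 1) / (j !) where instance _ = j !≢0

-- H_{m,n}(w) = Σ_{k=0}^{min(m,n)} C(m,k) C(n,k) k! w^k ; coefficient of w^k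

Hcoef : ℕ → ℕ → ℕ → ℕ
Hcoef m n k = if k ≤ᵇ (m ⊓ n) then (m C k) ℕ.* (n C k) ℕ.* (k !) else 0

-- Formal power series in three variables u, x, y over ℚ:
-- F a b c is the coefficient of u^a x^b y^c.

Series : Set
Series = ℕ → ℕ → ℕ → ℚ

infix 4 _≋_
_≋_ : Series → Series → Set
F ≋ G = ∀ a b c → F a b c ≡ G a b c

const : ℚ → Series
const q zero zero zero = q
const q _    _    _    = 0ℚ

U X Y : Series
U 1 0 0 = 1ℚ
U _ _ _ = 0ℚ
X 0 1 0 = 1ℚ
X _ _ _ = 0ℚ
Y 0 0 1 = 1ℚ
Y _ _ _ = 0ℚ

infixl 6 _⊕_ _⊖_
infixl 7 _⊛_ _·_

_⊕_ : Series → Series → Series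
(F ⊕ G) a b c = F a b c + G a b c

_⊖_ : Series → Series → Series
(F ⊖ G) a b c = F a b c - G a b c

_·_ : ℚ → Series → Series
(q · F) a b c = q * F a b c

_⊛_ : Series → Series → Series
(F ⊛ G) a b c =
  sumTo a λ i → sumTo b λ j → sumTo c λ k →
    F i j k * G (a ∸ i) (b ∸ j) (c ∸ k)

_^ˢ_ : Series → ℕ → Series
F ^ˢ zero  = const 1ℚ
F ^ˢ suc n = F ⊛ (F ^ˢ n)

-- Substitution of G into the univariate series Σ_j cs j t^j, i.e.
-- Σ_j cs j G^j.  This is meaningful (and the truncation j ≤ b + c exact)
-- whenever G has no monomial of x,y-degree 0, i.e. G a 0 0 = 0 for all a;
-- then G^j only contributes in x,y-degree ≥ j.
subst : (ℕ → ℚ) → Series → Series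
subst cs G a b c = sumTo (b ℕ.+ c) λ j → cs j * (G ^ˢ j) a b c

expS : Series → Series
expS = subst inv!

-- 1/(1 - G) = Σ_j G^j
inv1m : Series → Series
inv1m = subst (λ _ → 1ℚ)

gbinom : ℚ → ℕ → ℚ
gbinom α j = prodBelow j (λ i → α - ℕtoℚ i) * inv! j

-- (1 + G)^α = Σ_j binom(α,j) G^j
pow1p : ℚ → Series → Series
pow1p α = subst (gbinom α)

LHS1 : Series
LHS1 a m n = ℕtoℚ (Hcoef (2 ℕ.* m) n a) * inv! m * inv! n

LHS2 : Series
LHS2 a m n = ℕtoℚ (Hcoef (2 ℕ.* m) (2 ℕ.* n) a) * inv! m * inv! n

LHS3 : Series
LHS3 a m zero    = ℕtoℚ (Hcoef m m a) * inv! m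
LHS3 a m (suc _) = 0ℚ

two four : ℚ
two  = ℕtoℚ 2
four = ℕtoℚ 4

RHS1 : Series
RHS1 = expS (X ⊕ Y ⊕ two · (U ⊛ X ⊛ Y) ⊕ U ⊛ U ⊛ X ⊛ Y ⊛ Y)

RHS2 : Series
RHS2 =
  pow1p (- ((+ 1) / 2)) (const 0ℚ ⊖ four · (U ⊛ U ⊛ X ⊛ Y))
  ⊛ expS ((X ⊕ Y ⊕ four · (U ⊛ X ⊛ Y)) ⊛ inv1m (four · (U ⊛ U ⊛ X ⊛ Y)))

RHS3 : Series
RHS3 = inv1m (U ⊛ X) ⊛ expS (X ⊛ inv1m (U ⊛ X))

{-# OPTIONS --safe #-}
module Submission where

-- Both sides of each identity satisfy one linear differential equation in x,
-- (1 - x K)² ∂F = P F with ∂ = ∂/∂x and K, P polynomials in u, x, y, and they agree at x = 0.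
-- Solving the equation for ∂F expresses the coefficients of x^(n+1) through those of lower
-- x-degree, so the two sides coincide. On the left the equation comes from the recurrences
-- H_{p+1,q} = H_{p,q} + u q H_{p,q-1} and H_{p,q+1} = H_{p,q} + u p H_{p-1,q}, which link the
-- exponential generating functions of H_{σ(m),τ(n)} for the possible parities σ, τ of the
-- indices. On the right it comes from differentiating exp G, 1/(1 - G) and (1 + G)^α with the
-- chain rule.

open import Level using (0ℓ)
open import Data.Bool using (true; false; T)
open import Data.Empty using (⊥-elim)
open import Data.Maybe using (Maybe; just; nothing)
open import Data.Nat as ℕ using (ℕ; zero; suc; _≤_; _<_; z≤n; s≤s; _∸_; _!; _⊓_; _≤ᵇ_)
import Data.Nat.Properties as ℕ
open import Data.Nat.Combinatorics using (_C_; nCk+nC[k+1]≡[n+1]C[k+1]; k>n⇒nCk≡0; nC1≡n)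
open import Data.Nat.Solver renaming (module +-*-Solver to ℕ-Solver)
open import Data.Integer as ℤ using (+_)
import Data.Integer.Properties as ℤ
open import Data.Product using (_×_; _,_)
open import Data.Rational using (ℚ; 0ℚ; 1ℚ; _+_; _*_; -_; _-_; _/_; toℚᵘ)
open import Data.Rational.Properties
import Data.Rational.Unnormalised as ℚᵘ
import Data.Rational.Unnormalised.Properties as ℚᵘ
open import Data.Rational.Solver renaming (module +-*-Solver to ℚ-Solver)
open import Data.Sum using (inj₁; inj₂)
open import Function.Base using (id)
open import Relation.Binary.PropositionalEquality hiding (subst)
import Relation.Binary.PropositionalEquality as ≡
open import Relation.Binary.Bundles using (Setoid)
open import Relation.Nullary using (yes; no)
open import Algebra.Bundles using (CommutativeRing; CommutativeMonoid)
import Algebra.Solver.Ring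
import Algebra.Solver.Ring.AlmostCommutativeRing as ACR
import Algebra.Properties.CommutativeSemigroup as CommutativeSemigroupProperties
import Algebra.Properties.Group as GroupProperties
import Relation.Binary.Reasoning.Setoid as SetoidReasoning
open import Defs

open CommutativeSemigroupProperties (CommutativeMonoid.commutativeSemigroup *-1-commutativeMonoid) using (x∙yz≈y∙xz; x∙yz≈yx∙z)

toℚᵘ-ℕtoℚ : ∀ n → toℚᵘ (ℕtoℚ n) ℚᵘ.≃ ℚᵘ.mkℚᵘ (+ n) 0
toℚᵘ-ℕtoℚ n = toℚᵘ-fromℚᵘ (ℚᵘ.mkℚᵘ (+ n) 0)

ℕtoℚ-+ : ∀ m n → ℕtoℚ (m ℕ.+ n) ≡ ℕtoℚ m + ℕtoℚ n
ℕtoℚ-+ m n = toℚᵘ-injective (begin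
  toℚᵘ (ℕtoℚ (m ℕ.+ n))                  ≈⟨ toℚᵘ-ℕtoℚ (m ℕ.+ n) ⟩
  ℚᵘ.mkℚᵘ (+ (m ℕ.+ n)) 0                ≈⟨ ℚᵘ.*≡* (trans (ℤ.*-identityʳ _) (sym (trans (ℤ.*-identityʳ _)
                                                   (cong₂ ℤ._+_ (ℤ.*-identityʳ (+ m)) (ℤ.*-identityʳ (+ n)))))) ⟩
  ℚᵘ.mkℚᵘ (+ m) 0 ℚᵘ.+ ℚᵘ.mkℚᵘ (+ n) 0    ≈⟨ ℚᵘ.+-cong (toℚᵘ-ℕtoℚ m) (toℚᵘ-ℕtoℚ n) ⟨
  toℚᵘ (ℕtoℚ m) ℚᵘ.+ toℚᵘ (ℕtoℚ n)       ≈⟨ toℚᵘ-homo-+ (ℕtoℚ m) (ℕtoℚ n) ⟨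
  toℚᵘ (ℕtoℚ m + ℕtoℚ n)                 ∎)
  where
  open ℚᵘ.≃-Reasoning

ℕtoℚ-* : ∀ m n → ℕtoℚ (m ℕ.* n) ≡ ℕtoℚ m * ℕtoℚ n
ℕtoℚ-* m n = toℚᵘ-injective (begin
  toℚᵘ (ℕtoℚ (m ℕ.* n))                  ≈⟨ toℚᵘ-ℕtoℚ (m ℕ.* n) ⟩
  ℚᵘ.mkℚᵘ (+ (m ℕ.* n)) 0                ≈⟨ ℚᵘ.*≡* (trans (ℤ.*-identityʳ _) (sym (trans (ℤ.*-identityʳ _) (sym (ℤ.pos-* m n))))) ⟩
  ℚᵘ.mkℚᵘ (+ m) 0 ℚᵘ.* ℚᵘ.mkℚᵘ (+ n) 0    ≈⟨ ℚᵘ.*-cong (toℚᵘ-ℕtoℚ m) (toℚᵘ-ℕtoℚ n) ⟨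
  toℚᵘ (ℕtoℚ m) ℚᵘ.* toℚᵘ (ℕtoℚ n)       ≈⟨ toℚᵘ-homo-* (ℕtoℚ m) (ℕtoℚ n) ⟨
  toℚᵘ (ℕtoℚ m * ℕtoℚ n)                 ∎)
  where
  open ℚᵘ.≃-Reasoning

ℕtoℚ[n]*[1/n]≡1 : ∀ n .{{_ : ℕ.NonZero n}} → ℕtoℚ n * ((+ 1) / n) ≡ 1ℚ
ℕtoℚ[n]*[1/n]≡1 (suc n) = toℚᵘ-injective (begin
  toℚᵘ (ℕtoℚ (suc n) * ((+ 1) / suc n))             ≈⟨ toℚᵘ-homo-* (ℕtoℚ (suc n)) ((+ 1) / suc n) ⟩
  toℚᵘ (ℕtoℚ (suc n)) ℚᵘ.* toℚᵘ ((+ 1) / suc n)     ≈⟨ ℚᵘ.*-cong (toℚᵘ-ℕtoℚ (suc n)) (toℚᵘ-fromℚᵘ (ℚᵘ.mkℚᵘ (+ 1) n)) ⟩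
  ℚᵘ.mkℚᵘ (+ suc n) 0 ℚᵘ.* ℚᵘ.mkℚᵘ (+ 1) n          ≈⟨ ℚᵘ.*-inverseʳ (ℚᵘ.mkℚᵘ (+ suc n) 0) ⟩
  ℚᵘ.1ℚᵘ                                           ∎)
  where
  open ℚᵘ.≃-Reasoning

ℕtoℚ[n!]*inv!n≡1 : ∀ n → ℕtoℚ (n !) * inv! n ≡ 1ℚ
ℕtoℚ[n!]*inv!n≡1 n = ℕtoℚ[n]*[1/n]≡1 (n !) {{n ℕ.!≢0}}

ℕtoℚ[1+n]*inv![1+n]≡inv!n : ∀ n → ℕtoℚ (suc n) * inv! (suc n) ≡ inv! n
ℕtoℚ[1+n]*inv![1+n]≡inv!n n = begin
  m * w                 ≡⟨ *-identityʳ (m * w) ⟨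
  m * w * 1ℚ            ≡⟨ cong (m * w *_) (sym (ℕtoℚ[n!]*inv!n≡1 n)) ⟩
  m * w * (f * inv! n)  ≡⟨ solve 4 (λ m w f v → m :* w :* (f :* v) := (m :* f) :* w :* v) refl m w f (inv! n) ⟩
  m * f * w * inv! n    ≡⟨ cong (λ q → q * w * inv! n) (sym (ℕtoℚ-* (suc n) (n !))) ⟩
  ℕtoℚ (suc n !) * w * inv! n ≡⟨ cong (_* inv! n) (ℕtoℚ[n!]*inv!n≡1 (suc n)) ⟩
  1ℚ * inv! n           ≡⟨ *-identityˡ (inv! n) ⟩
  inv! n                ∎
  where
  open ≡-Reasoning
  open ℚ-Solver
  m f w : ℚ
  m = ℕtoℚ (suc n)
  f = ℕtoℚ (n !)
  w = inv! (suc n)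

ℕtoℚ[1+n]*p≡0⇒p≡0 : ∀ n {p} → ℕtoℚ (suc n) * p ≡ 0ℚ → p ≡ 0ℚ
ℕtoℚ[1+n]*p≡0⇒p≡0 n {p} eq = begin
  p                                    ≡⟨ sym (*-identityˡ p) ⟩
  1ℚ * p                               ≡⟨ cong (_* p) (sym (ℕtoℚ[n!]*inv!n≡1 n)) ⟩
  ℕtoℚ (n !) * inv! n * p              ≡⟨ cong (λ q → ℕtoℚ (n !) * q * p) (sym (ℕtoℚ[1+n]*inv![1+n]≡inv!n n)) ⟩
  ℕtoℚ (n !) * (ℕtoℚ (suc n) * inv! (suc n)) * p
    ≡⟨ solve 4 (λ f m w p → f :* (m :* w) :* p := f :* w :* (m :* p)) refl (ℕtoℚ (n !)) (ℕtoℚ (suc n)) (inv! (suc n)) p ⟩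
  ℕtoℚ (n !) * inv! (suc n) * (ℕtoℚ (suc n) * p) ≡⟨ cong (ℕtoℚ (n !) * inv! (suc n) *_) eq ⟩
  ℕtoℚ (n !) * inv! (suc n) * 0ℚ       ≡⟨ *-zeroʳ (ℕtoℚ (n !) * inv! (suc n)) ⟩
  0ℚ                                   ∎
  where
  open ℚ-Solver
  open ≡-Reasoning

Σ-cong≤ : ∀ n {f g : ℕ → ℚ} → (∀ i → i ≤ n → f i ≡ g i) → sumTo n f ≡ sumTo n g
Σ-cong≤ zero    eq = eq 0 z≤n
Σ-cong≤ (suc n) eq = cong₂ _+_ (Σ-cong≤ n (λ i i≤n → eq i (ℕ.m≤n⇒m≤1+n i≤n))) (eq (suc n) ℕ.≤-refl)

Σ-cong : ∀ n {f g : ℕ → ℚ} → (∀ i → f i ≡ g i) → sumTo n f ≡ sumTo n g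
Σ-cong n eq = Σ-cong≤ n (λ i _ → eq i)

Σ-zero : ∀ n {f : ℕ → ℚ} → (∀ i → i ≤ n → f i ≡ 0ℚ) → sumTo n f ≡ 0ℚ
Σ-zero zero    eq = eq 0 z≤n
Σ-zero (suc n) eq = trans (cong₂ _+_ (Σ-zero n (λ i i≤n → eq i (ℕ.m≤n⇒m≤1+n i≤n))) (eq (suc n) ℕ.≤-refl)) (+-identityʳ 0ℚ)

Σ-distrib-+ : ∀ n (f g : ℕ → ℚ) → sumTo n (λ i → f i + g i) ≡ sumTo n f + sumTo n g
Σ-distrib-+ zero    f g = refl
Σ-distrib-+ (suc n) f g = trans (cong (_+ (f (suc n) + g (suc n))) (Σ-distrib-+ n f g))
  (solve 4 (λ a b c d → (a :+ b) :+ (c :+ d) := (a :+ c) :+ (b :+ d)) refl (sumTo n f) (sumTo n g) (f (suc n)) (g (suc n)))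
  where
  open ℚ-Solver

*-distribˡ-Σ : ∀ n q (f : ℕ → ℚ) → q * sumTo n f ≡ sumTo n (λ i → q * f i)
*-distribˡ-Σ zero    q f = refl
*-distribˡ-Σ (suc n) q f = trans (*-distribˡ-+ q (sumTo n f) (f (suc n))) (cong (_+ q * f (suc n)) (*-distribˡ-Σ n q f))

*-distribʳ-Σ : ∀ n q (f : ℕ → ℚ) → sumTo n f * q ≡ sumTo n (λ i → f i * q)
*-distribʳ-Σ zero    q f = refl
*-distribʳ-Σ (suc n) q f = trans (*-distribʳ-+ q (sumTo n f) (f (suc n))) (cong (_+ f (suc n) * q) (*-distribʳ-Σ n q f))

Σ-comm : ∀ n m (f : ℕ → ℕ → ℚ) → sumTo n (λ i → sumTo m (f i)) ≡ sumTo m (λ j → sumTo n (λ i → f i j))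
Σ-comm zero    m f = refl
Σ-comm (suc n) m f = trans (cong (_+ sumTo m (f (suc n))) (Σ-comm n m f)) (sym (Σ-distrib-+ m _ (f (suc n))))

Σ-suc : ∀ n (f : ℕ → ℚ) → sumTo (suc n) f ≡ f 0 + sumTo n (λ i → f (suc i))
Σ-suc zero    f = refl
Σ-suc (suc n) f = trans (cong (_+ f (suc (suc n))) (Σ-suc n f)) (+-assoc (f 0) _ _)

Σ-reverse : ∀ n (f : ℕ → ℚ) → sumTo n f ≡ sumTo n (λ i → f (n ∸ i))
Σ-reverse zero    f = refl
Σ-reverse (suc n) f = begin
  sumTo n f + f (suc n)                    ≡⟨ +-comm (sumTo n f) _ ⟩
  f (suc n) + sumTo n f                    ≡⟨ cong (_+_ (f (suc n))) (Σ-reverse n f) ⟩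
  f (suc n) + sumTo n (λ i → f (n ∸ i))    ≡⟨ sym (Σ-suc n (λ i → f (suc n ∸ i))) ⟩
  sumTo (suc n) (λ i → f (suc n ∸ i))      ∎
  where
  open ≡-Reasoning

Σ-extend : ∀ n m {f : ℕ → ℚ} → n ≤ m → (∀ i → n < i → i ≤ m → f i ≡ 0ℚ) → sumTo m f ≡ sumTo n f
Σ-extend n zero    z≤n _ = refl
Σ-extend n (suc m) {f} n≤1+m vanish with ℕ.m≤n⇒m<n∨m≡n n≤1+m
... | inj₂ refl    = refl
... | inj₁ (s≤s n≤m) = begin
  sumTo m f + f (suc m) ≡⟨ cong₂ _+_ (Σ-extend n m n≤m (λ i n<i i≤m → vanish i n<i (ℕ.m≤n⇒m≤1+n i≤m)))
                                     (vanish (suc m) (s≤s n≤m) ℕ.≤-refl) ⟩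
  sumTo n f + 0ℚ        ≡⟨ +-identityʳ (sumTo n f) ⟩
  sumTo n f             ∎
  where
  open ≡-Reasoning

Σ-single : ∀ n k {f : ℕ → ℚ} → k ≤ n → (∀ i → i ≤ n → i ≢ k → f i ≡ 0ℚ) → sumTo n f ≡ f k
Σ-single zero    .zero z≤n _ = refl
Σ-single (suc n) k {f} k≤1+n vanish with ℕ.m≤n⇒m<n∨m≡n k≤1+n
... | inj₂ refl = trans (cong (_+ f (suc n)) (Σ-zero n (λ i i≤n → vanish i (ℕ.m≤n⇒m≤1+n i≤n) (λ { refl → ℕ.1+n≰n i≤n }))))
                        (+-identityˡ (f (suc n)))
... | inj₁ (s≤s k≤n) = trans (cong₂ _+_ (Σ-single n k k≤n (λ i i≤n → vanish i (ℕ.m≤n⇒m≤1+n i≤n)))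
                                        (vanish (suc n) ℕ.≤-refl (λ { refl → ℕ.1+n≰n k≤n })))
                             (+-identityʳ (f k))

Σ-triangle : ∀ n (f : ℕ → ℕ → ℚ) →
             sumTo n (λ i → sumTo i (f i)) ≡ sumTo n (λ j → sumTo (n ∸ j) (λ k → f (j ℕ.+ k) j))
Σ-triangle zero    f = refl
Σ-triangle (suc n) f = begin
  sumTo n (λ i → sumTo i (f i)) + (sumTo n (f (suc n)) + f (suc n) (suc n))
    ≡⟨ cong (_+ (sumTo n (f (suc n)) + f (suc n) (suc n))) (Σ-triangle n f) ⟩
  columns n + (sumTo n (f (suc n)) + f (suc n) (suc n))
    ≡⟨ sym (+-assoc (columns n) (sumTo n (f (suc n))) (f (suc n) (suc n))) ⟩
  columns n + sumTo n (f (suc n)) + f (suc n) (suc n)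
    ≡⟨ cong₂ _+_ (sym (Σ-distrib-+ n _ (f (suc n)))) (cong (λ i → f i (suc n)) (sym (ℕ.+-identityʳ (suc n)))) ⟩
  sumTo n (λ j → sumTo (n ∸ j) (λ k → f (j ℕ.+ k) j) + f (suc n) j) + f (suc n ℕ.+ 0) (suc n)
    ≡⟨ cong₂ _+_ (Σ-cong≤ n (λ j j≤n → sym (last-row j j≤n)))
                 (cong (λ m → sumTo m (λ k → f (suc n ℕ.+ k) (suc n))) (sym (ℕ.n∸n≡0 n))) ⟩
  columns (suc n) ∎
  where
  open ≡-Reasoning
  columns : ℕ → ℚ
  columns m = sumTo m (λ j → sumTo (m ∸ j) (λ k → f (j ℕ.+ k) j))
  last-row : ∀ j → j ≤ n → sumTo (suc n ∸ j) (λ k → f (j ℕ.+ k) j) ≡ sumTo (n ∸ j) (λ k → f (j ℕ.+ k) j) + f (suc n) j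
  last-row j j≤n rewrite ℕ.+-∸-assoc 1 j≤n =
    cong (λ i → sumTo (n ∸ j) (λ k → f (j ℕ.+ k) j) + f i j) (trans (ℕ.+-suc j (n ∸ j)) (cong suc (ℕ.m+[n∸m]≡n j≤n)))

Σ³ : ℕ → ℕ → ℕ → (ℕ → ℕ → ℕ → ℚ) → ℚ
Σ³ a b c f = sumTo a λ i → sumTo b λ j → sumTo c λ k → f i j k

Σ³-cong : ∀ a b c {f g : ℕ → ℕ → ℕ → ℚ} → (∀ i j k → f i j k ≡ g i j k) → Σ³ a b c f ≡ Σ³ a b c g
Σ³-cong a b c eq = Σ-cong a λ i → Σ-cong b λ j → Σ-cong c λ k → eq i j k

Σ³-cong≤ : ∀ a b c {f g : ℕ → ℕ → ℕ → ℚ} → (∀ i j k → i ≤ a → j ≤ b → k ≤ c → f i j k ≡ g i j k) →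
           Σ³ a b c f ≡ Σ³ a b c g
Σ³-cong≤ a b c eq = Σ-cong≤ a λ i i≤a → Σ-cong≤ b λ j j≤b → Σ-cong≤ c λ k k≤c → eq i j k i≤a j≤b k≤c

Σ³-zero : ∀ a b c {f : ℕ → ℕ → ℕ → ℚ} → (∀ i j k → i ≤ a → j ≤ b → k ≤ c → f i j k ≡ 0ℚ) → Σ³ a b c f ≡ 0ℚ
Σ³-zero a b c eq = Σ-zero a λ i i≤a → Σ-zero b λ j j≤b → Σ-zero c λ k k≤c → eq i j k i≤a j≤b k≤c

Σ³-distrib-+ : ∀ a b c (f g : ℕ → ℕ → ℕ → ℚ) → Σ³ a b c (λ i j k → f i j k + g i j k) ≡ Σ³ a b c f + Σ³ a b c g
Σ³-distrib-+ a b c f g =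
  trans (Σ-cong a λ i → trans (Σ-cong b λ j → Σ-distrib-+ c _ _) (Σ-distrib-+ b _ _)) (Σ-distrib-+ a _ _)

*-distribˡ-Σ³ : ∀ a b c q (f : ℕ → ℕ → ℕ → ℚ) → q * Σ³ a b c f ≡ Σ³ a b c (λ i j k → q * f i j k)
*-distribˡ-Σ³ a b c q f =
  trans (*-distribˡ-Σ a q _) (Σ-cong a λ i → trans (*-distribˡ-Σ b q _) (Σ-cong b λ j → *-distribˡ-Σ c q _))

*-distribʳ-Σ³ : ∀ a b c q (f : ℕ → ℕ → ℕ → ℚ) → Σ³ a b c f * q ≡ Σ³ a b c (λ i j k → f i j k * q)
*-distribʳ-Σ³ a b c q f =
  trans (*-distribʳ-Σ a q _) (Σ-cong a λ i → trans (*-distribʳ-Σ b q _) (Σ-cong b λ j → *-distribʳ-Σ c q _))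

Σ³-comm-Σ : ∀ n a b c (f : ℕ → ℕ → ℕ → ℕ → ℚ) →
            Σ³ a b c (λ i j k → sumTo n (λ t → f t i j k)) ≡ sumTo n (λ t → Σ³ a b c (f t))
Σ³-comm-Σ n a b c f =
  trans (Σ-cong a λ i → trans (Σ-cong b λ j → Σ-comm c n _) (Σ-comm b n _)) (Σ-comm a n _)

Σ³-reverse : ∀ a b c (f : ℕ → ℕ → ℕ → ℚ) → Σ³ a b c f ≡ Σ³ a b c (λ i j k → f (a ∸ i) (b ∸ j) (c ∸ k))
Σ³-reverse a b c f =
  trans (Σ-reverse a _) (Σ-cong a λ i → trans (Σ-reverse b _) (Σ-cong b λ j → Σ-reverse c _))

Σ³-triangle : ∀ a b c (f : ℕ → ℕ → ℕ → ℕ → ℕ → ℕ → ℚ) →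
  Σ³ a b c (λ i j k → Σ³ i j k (f i j k)) ≡
  Σ³ a b c (λ i j k → Σ³ (a ∸ i) (b ∸ j) (c ∸ k) (λ p q r → f (i ℕ.+ p) (j ℕ.+ q) (k ℕ.+ r) i j k))
Σ³-triangle a b c f = begin
  Σ³ a b c (λ i j k → Σ³ i j k (f i j k))
    ≡⟨ Σ-cong a (λ i → trans (Σ-cong b (λ j → Σ-comm c i _)) (Σ-comm b i _)) ⟩
  sumTo a (λ i → sumTo i (λ i′ → sumTo b (λ j → sumTo c (λ k → sumTo j (λ j′ → sumTo k (f i j k i′ j′))))))
    ≡⟨ Σ-triangle a _ ⟩
  sumTo a (λ i′ → sumTo (a ∸ i′) (λ p → sumTo b (λ j → sumTo c (λ k → sumTo j (λ j′ → sumTo k (f (i′ ℕ.+ p) j k i′ j′))))))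
    ≡⟨ Σ-cong a (λ i′ → Σ-cong (a ∸ i′) (λ p → inner (λ j k → f (i′ ℕ.+ p) j k i′))) ⟩
  sumTo a (λ i′ → sumTo (a ∸ i′) (λ p → sumTo b (λ j′ → sumTo c (λ k′ → sumTo (b ∸ j′) (λ q → sumTo (c ∸ k′) (λ r →
    f (i′ ℕ.+ p) (j′ ℕ.+ q) (k′ ℕ.+ r) i′ j′ k′))))))
    ≡⟨ Σ-cong a (λ i′ → trans (Σ-comm (a ∸ i′) b _) (Σ-cong b λ j′ → Σ-comm (a ∸ i′) c _)) ⟩
  Σ³ a b c (λ i j k → Σ³ (a ∸ i) (b ∸ j) (c ∸ k) (λ p q r → f (i ℕ.+ p) (j ℕ.+ q) (k ℕ.+ r) i j k)) ∎
  where
  open ≡-Reasoning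
  inner : ∀ (g : ℕ → ℕ → ℕ → ℕ → ℚ) →
    sumTo b (λ j → sumTo c (λ k → sumTo j (λ j′ → sumTo k (g j k j′)))) ≡
    sumTo b (λ j′ → sumTo c (λ k′ → sumTo (b ∸ j′) (λ q → sumTo (c ∸ k′) (λ r → g (j′ ℕ.+ q) (k′ ℕ.+ r) j′ k′))))
  inner g = begin
    sumTo b (λ j → sumTo c (λ k → sumTo j (λ j′ → sumTo k (g j k j′))))
      ≡⟨ Σ-cong b (λ j → Σ-comm c j _) ⟩
    sumTo b (λ j → sumTo j (λ j′ → sumTo c (λ k → sumTo k (g j k j′))))
      ≡⟨ Σ-triangle b _ ⟩
    sumTo b (λ j′ → sumTo (b ∸ j′) (λ q → sumTo c (λ k → sumTo k (g (j′ ℕ.+ q) k j′))))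
      ≡⟨ Σ-cong b (λ j′ → Σ-cong (b ∸ j′) (λ q → Σ-triangle c _)) ⟩
    sumTo b (λ j′ → sumTo (b ∸ j′) (λ q → sumTo c (λ k′ → sumTo (c ∸ k′) (λ r → g (j′ ℕ.+ q) (k′ ℕ.+ r) j′ k′))))
      ≡⟨ Σ-cong b (λ j′ → Σ-comm (b ∸ j′) c _) ⟩
    sumTo b (λ j′ → sumTo c (λ k′ → sumTo (b ∸ j′) (λ q → sumTo (c ∸ k′) (λ r → g (j′ ℕ.+ q) (k′ ℕ.+ r) j′ k′)))) ∎

-- The ring of power series in u, x, y

0ˢ 1ˢ : Series
0ˢ = const 0ℚ
1ˢ = const 1ℚ

-ˢ_ : Series → Series
(-ˢ F) a b c = - F a b c

0ˢ-coeff : ∀ a b c → 0ˢ a b c ≡ 0ℚ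
0ˢ-coeff zero    zero    zero    = refl
0ˢ-coeff zero    zero    (suc c) = refl
0ˢ-coeff zero    (suc b) c       = refl
0ˢ-coeff (suc a) b       c       = refl

≋-refl : ∀ {F} → F ≋ F
≋-refl a b c = refl

≋-sym : ∀ {F G} → F ≋ G → G ≋ F
≋-sym e a b c = sym (e a b c)

≋-trans : ∀ {F G H} → F ≋ G → G ≋ H → F ≋ H
≋-trans e f a b c = trans (e a b c) (f a b c)

≡⇒≋ : ∀ {F G} → F ≡ G → F ≋ G
≡⇒≋ refl = ≋-refl

⊕-cong : ∀ {F F′ G G′} → F ≋ F′ → G ≋ G′ → F ⊕ G ≋ F′ ⊕ G′
⊕-cong e f a b c = cong₂ _+_ (e a b c) (f a b c)

⊕-congˡ : ∀ F {G G′} → G ≋ G′ → F ⊕ G ≋ F ⊕ G′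
⊕-congˡ F = ⊕-cong (≋-refl {F})

⊕-congʳ : ∀ {F F′} G → F ≋ F′ → F ⊕ G ≋ F′ ⊕ G
⊕-congʳ G F≋F′ = ⊕-cong F≋F′ (≋-refl {G})

-ˢ-cong : ∀ {F G} → F ≋ G → -ˢ F ≋ -ˢ G
-ˢ-cong e a b c = cong -_ (e a b c)

·-cong : ∀ q {F G} → F ≋ G → q · F ≋ q · G
·-cong q e a b c = cong (q *_) (e a b c)

⊛-cong : ∀ {F F′ G G′} → F ≋ F′ → G ≋ G′ → F ⊛ G ≋ F′ ⊛ G′
⊛-cong e f a b c = Σ³-cong a b c λ i j k → cong₂ _*_ (e i j k) (f (a ∸ i) (b ∸ j) (c ∸ k))

⊛-congˡ : ∀ F {G G′} → G ≋ G′ → F ⊛ G ≋ F ⊛ G′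
⊛-congˡ F = ⊛-cong (≋-refl {F})

⊛-congʳ : ∀ {F F′} G → F ≋ F′ → F ⊛ G ≋ F′ ⊛ G
⊛-congʳ G F≋F′ = ⊛-cong F≋F′ (≋-refl {G})

⊛-comm : ∀ F G → F ⊛ G ≋ G ⊛ F
⊛-comm F G a b c = trans (Σ³-reverse a b c _) (Σ³-cong≤ a b c λ i j k i≤a j≤b k≤c → begin
  F (a ∸ i) (b ∸ j) (c ∸ k) * G (a ∸ (a ∸ i)) (b ∸ (b ∸ j)) (c ∸ (c ∸ k))
    ≡⟨ cong₂ (λ i′ j′ → F (a ∸ i) (b ∸ j) (c ∸ k) * G i′ j′ (c ∸ (c ∸ k))) (ℕ.m∸[m∸n]≡n i≤a) (ℕ.m∸[m∸n]≡n j≤b) ⟩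
  F (a ∸ i) (b ∸ j) (c ∸ k) * G i j (c ∸ (c ∸ k))
    ≡⟨ cong (λ k′ → F (a ∸ i) (b ∸ j) (c ∸ k) * G i j k′) (ℕ.m∸[m∸n]≡n k≤c) ⟩
  F (a ∸ i) (b ∸ j) (c ∸ k) * G i j k
    ≡⟨ *-comm (F (a ∸ i) (b ∸ j) (c ∸ k)) (G i j k) ⟩
  G i j k * F (a ∸ i) (b ∸ j) (c ∸ k) ∎)
  where
  open ≡-Reasoning

⊛-assoc : ∀ F G H → (F ⊛ G) ⊛ H ≋ F ⊛ (G ⊛ H)
⊛-assoc F G H a b c = begin
  ((F ⊛ G) ⊛ H) a b c
    ≡⟨ Σ³-cong a b c (λ i j k → *-distribʳ-Σ³ i j k (H (a ∸ i) (b ∸ j) (c ∸ k)) _) ⟩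
  Σ³ a b c (λ i j k → Σ³ i j k (λ i′ j′ k′ → F i′ j′ k′ * G (i ∸ i′) (j ∸ j′) (k ∸ k′) * H (a ∸ i) (b ∸ j) (c ∸ k)))
    ≡⟨ Σ³-triangle a b c _ ⟩
  Σ³ a b c (λ i j k → Σ³ (a ∸ i) (b ∸ j) (c ∸ k) (λ p q r →
    F i j k * G (i ℕ.+ p ∸ i) (j ℕ.+ q ∸ j) (k ℕ.+ r ∸ k) * H (a ∸ (i ℕ.+ p)) (b ∸ (j ℕ.+ q)) (c ∸ (k ℕ.+ r))))
    ≡⟨ Σ³-cong a b c (λ i j k → Σ³-cong (a ∸ i) (b ∸ j) (c ∸ k) (reindex i j k)) ⟩
  Σ³ a b c (λ i j k → Σ³ (a ∸ i) (b ∸ j) (c ∸ k) (λ p q r → F i j k * (G p q r * H (a ∸ i ∸ p) (b ∸ j ∸ q) (c ∸ k ∸ r))))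
    ≡⟨ Σ³-cong a b c (λ i j k → sym (*-distribˡ-Σ³ (a ∸ i) (b ∸ j) (c ∸ k) (F i j k) _)) ⟩
  (F ⊛ (G ⊛ H)) a b c ∎
  where
  open ≡-Reasoning
  reindex : ∀ i j k p q r →
    F i j k * G (i ℕ.+ p ∸ i) (j ℕ.+ q ∸ j) (k ℕ.+ r ∸ k) * H (a ∸ (i ℕ.+ p)) (b ∸ (j ℕ.+ q)) (c ∸ (k ℕ.+ r)) ≡
    F i j k * (G p q r * H (a ∸ i ∸ p) (b ∸ j ∸ q) (c ∸ k ∸ r))
  reindex i j k p q r
    rewrite ℕ.m+n∸m≡n i p | ℕ.m+n∸m≡n j q | ℕ.m+n∸m≡n k r
          | sym (ℕ.∸-+-assoc a i p) | sym (ℕ.∸-+-assoc b j q) | sym (ℕ.∸-+-assoc c k r)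
    = *-assoc (F i j k) (G p q r) (H (a ∸ i ∸ p) (b ∸ j ∸ q) (c ∸ k ∸ r))

⊛-identityˡ : ∀ F → 1ˢ ⊛ F ≋ F
⊛-identityˡ F a b c = begin
  (1ˢ ⊛ F) a b c
    ≡⟨ Σ-single a 0 z≤n (λ { zero _ 0≢0 → ⊥-elim (0≢0 refl)
                           ; (suc i) _ _ → Σ-zero b λ j _ → Σ-zero c λ k _ → *-zeroˡ (F (a ∸ suc i) (b ∸ j) (c ∸ k)) }) ⟩
  sumTo b (λ j → sumTo c (λ k → 1ˢ 0 j k * F a (b ∸ j) (c ∸ k)))
    ≡⟨ Σ-single b 0 z≤n (λ { zero _ 0≢0 → ⊥-elim (0≢0 refl)
                           ; (suc j) _ _ → Σ-zero c λ k _ → *-zeroˡ (F a (b ∸ suc j) (c ∸ k)) }) ⟩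
  sumTo c (λ k → 1ˢ 0 0 k * F a b (c ∸ k))
    ≡⟨ Σ-single c 0 z≤n (λ { zero _ 0≢0 → ⊥-elim (0≢0 refl) ; (suc k) _ _ → *-zeroˡ (F a b (c ∸ suc k)) }) ⟩
  1ℚ * F a b c
    ≡⟨ *-identityˡ (F a b c) ⟩
  F a b c ∎
  where
  open ≡-Reasoning

⊛-identityʳ : ∀ F → F ⊛ 1ˢ ≋ F
⊛-identityʳ F = ≋-trans (⊛-comm F 1ˢ) (⊛-identityˡ F)

⊛-distribˡ-⊕ : ∀ F G H → F ⊛ (G ⊕ H) ≋ F ⊛ G ⊕ F ⊛ H
⊛-distribˡ-⊕ F G H a b c = trans
  (Σ³-cong a b c λ i j k → *-distribˡ-+ (F i j k) (G (a ∸ i) (b ∸ j) (c ∸ k)) (H (a ∸ i) (b ∸ j) (c ∸ k)))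
  (Σ³-distrib-+ a b c _ _)

·-identityˡ : ∀ F → 1ℚ · F ≋ F
·-identityˡ F a b c = *-identityˡ (F a b c)

·-⊛ : ∀ q F G → (q · F) ⊛ G ≋ q · (F ⊛ G)
·-⊛ q F G a b c = trans (Σ³-cong a b c λ i j k → *-assoc q (F i j k) (G (a ∸ i) (b ∸ j) (c ∸ k)))
                        (sym (*-distribˡ-Σ³ a b c q _))

seriesRing : CommutativeRing 0ℓ 0ℓ
seriesRing = record
  { Carrier = Series ; _≈_ = _≋_ ; _+_ = _⊕_ ; _*_ = _⊛_ ; -_ = -ˢ_ ; 0# = 0ˢ ; 1# = 1ˢ
  ; isCommutativeRing = record
    { isRing = record
      { +-isAbelianGroup = record
        { isGroup = record
          { isMonoid = record
            { isSemigroup = record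
              { isMagma = record
                { isEquivalence = record { refl = ≋-refl ; sym = ≋-sym ; trans = ≋-trans }
                ; ∙-cong = ⊕-cong }
              ; assoc = λ F G H a b c → +-assoc (F a b c) (G a b c) (H a b c) }
            ; identity = (λ F a b c → trans (cong (_+ F a b c) (0ˢ-coeff a b c)) (+-identityˡ (F a b c)))
                       , (λ F a b c → trans (cong (_+_ (F a b c)) (0ˢ-coeff a b c)) (+-identityʳ (F a b c))) }
          ; inverse = (λ F a b c → trans (+-inverseˡ (F a b c)) (sym (0ˢ-coeff a b c)))
                    , (λ F a b c → trans (+-inverseʳ (F a b c)) (sym (0ˢ-coeff a b c)))
          ; ⁻¹-cong = -ˢ-cong }
        ; comm = λ F G a b c → +-comm (F a b c) (G a b c) }
      ; *-cong = ⊛-cong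
      ; *-assoc = ⊛-assoc
      ; *-identity = ⊛-identityˡ , ⊛-identityʳ
      ; distrib = ⊛-distribˡ-⊕
                , λ F G H → ≋-trans (⊛-comm (G ⊕ H) F) (≋-trans (⊛-distribˡ-⊕ F G H) (⊕-cong (⊛-comm F G) (⊛-comm F H))) }
    ; *-comm = ⊛-comm } }

·≋const⊛ : ∀ q F → q · F ≋ const q ⊛ F
·≋const⊛ q F = ≋-sym (≋-trans {G = (q · 1ˢ) ⊛ F} (⊛-congʳ F const≋q·1ˢ) (≋-trans (·-⊛ q 1ˢ F) (·-cong q (⊛-identityˡ F))))
  where
  const≋q·1ˢ : const q ≋ q · 1ˢ
  const≋q·1ˢ zero    zero    zero    = sym (*-identityʳ q)
  const≋q·1ˢ zero    zero    (suc c) = sym (*-zeroʳ q)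
  const≋q·1ˢ zero    (suc b) c       = sym (*-zeroʳ q)
  const≋q·1ˢ (suc a) b       c       = sym (*-zeroʳ q)

const-+ : ∀ p q → const (p + q) ≋ const p ⊕ const q
const-+ p q zero    zero    zero    = refl
const-+ p q zero    zero    (suc c) = refl
const-+ p q zero    (suc b) c       = refl
const-+ p q (suc a) b       c       = refl

const-neg : ∀ q → const (- q) ≋ -ˢ const q
const-neg q zero    zero    zero    = refl
const-neg q zero    zero    (suc c) = refl
const-neg q zero    (suc b) c       = refl
const-neg q (suc a) b       c       = refl

const-* : ∀ p q → const (p * q) ≋ const p ⊛ const q
const-* p q = ≋-trans const[p*q]≋p·const[q] (·≋const⊛ p (const q))
  where
  const[p*q]≋p·const[q] : const (p * q) ≋ p · const q
  const[p*q]≋p·const[q] zero    zero    zero    = refl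
  const[p*q]≋p·const[q] zero    zero    (suc c) = sym (*-zeroʳ p)
  const[p*q]≋p·const[q] zero    (suc b) c       = sym (*-zeroʳ p)
  const[p*q]≋p·const[q] (suc a) b       c       = sym (*-zeroʳ p)

seriesACR : ACR.AlmostCommutativeRing 0ℓ 0ℓ
seriesACR = ACR.fromCommutativeRing seriesRing

const-morphism : +-*-rawRing ACR.-Raw-AlmostCommutative⟶ seriesACR
const-morphism = record
  { ⟦_⟧ = const ; +-homo = const-+ ; *-homo = const-* ; -‿homo = const-neg ; 0-homo = ≋-refl ; 1-homo = ≋-refl }

const-≟ : ∀ p q → Maybe (const p ≋ const q)
const-≟ p q with p ≟ q
... | yes refl = just ≋-refl
... | no  _    = nothing

module ˢ-Solver = Algebra.Solver.Ring +-*-rawRing seriesACR const-morphism const-≟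

module ≋-Reasoning = SetoidReasoning (CommutativeRing.setoid seriesRing)

fixpoint-elim : ∀ {A B K} → A ≋ B ⊕ X ⊛ (K ⊛ A) → (1ˢ ⊖ X ⊛ K) ⊛ A ≋ B
fixpoint-elim {A} {B} {K} A≋ = begin
  (1ˢ ⊖ X ⊛ K) ⊛ A                    ≈⟨ solve 3 (λ x k a → (con 1ℚ :- x :* k) :* a := a :- x :* (k :* a)) ≋-refl X K A ⟩
  A ⊖ X ⊛ (K ⊛ A)                     ≈⟨ ⊕-congʳ (-ˢ (X ⊛ (K ⊛ A))) A≋ ⟩
  B ⊕ X ⊛ (K ⊛ A) ⊖ X ⊛ (K ⊛ A)       ≈⟨ solve 4 (λ x k a b → b :+ x :* (k :* a) :- x :* (k :* a) := b) ≋-refl X K A B ⟩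
  B                                   ∎
  where
  open ≋-Reasoning
  open ˢ-Solver

shiftU shiftX shiftY : Series → Series
shiftU F zero    b c = 0ℚ
shiftU F (suc a) b c = F a b c
shiftX F a zero    c = 0ℚ
shiftX F a (suc b) c = F a b c
shiftY F a b zero    = 0ℚ
shiftY F a b (suc c) = F a b c

shiftU-cong : ∀ {F G} → F ≋ G → shiftU F ≋ shiftU G
shiftU-cong e zero    b c = refl
shiftU-cong e (suc a) b c = e a b c

shiftX-cong : ∀ {F G} → F ≋ G → shiftX F ≋ shiftX G
shiftX-cong e a zero    c = refl
shiftX-cong e a (suc b) c = e a b c

shiftY-cong : ∀ {F G} → F ≋ G → shiftY F ≋ shiftY G
shiftY-cong e a b zero    = refl
shiftY-cong e a b (suc c) = e a b c

shiftU-⊛ : ∀ F G → shiftU F ⊛ G ≋ shiftU (F ⊛ G)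
shiftU-⊛ F G zero    b c = Σ-zero b λ j _ → Σ-zero c λ k _ → *-zeroˡ (G 0 (b ∸ j) (c ∸ k))
shiftU-⊛ F G (suc a) b c = trans (Σ-suc a _)
  (trans (cong (_+ (F ⊛ G) a b c) (Σ-zero b λ j _ → Σ-zero c λ k _ → *-zeroˡ (G (suc a) (b ∸ j) (c ∸ k))))
         (+-identityˡ ((F ⊛ G) a b c)))

shiftX-⊛ : ∀ F G → shiftX F ⊛ G ≋ shiftX (F ⊛ G)
shiftX-⊛ F G a zero    c = Σ-zero a λ i _ → Σ-zero c λ k _ → *-zeroˡ (G (a ∸ i) 0 (c ∸ k))
shiftX-⊛ F G a (suc b) c = Σ-cong a λ i → trans (Σ-suc b _)
  (trans (cong (_+ sumTo b (λ j → sumTo c (λ k → F i j k * G (a ∸ i) (b ∸ j) (c ∸ k))))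
               (Σ-zero c λ k _ → *-zeroˡ (G (a ∸ i) (suc b) (c ∸ k))))
         (+-identityˡ _))

shiftY-⊛ : ∀ F G → shiftY F ⊛ G ≋ shiftY (F ⊛ G)
shiftY-⊛ F G a b zero    = Σ-zero a λ i _ → Σ-zero b λ j _ → *-zeroˡ (G (a ∸ i) (b ∸ j) 0)
shiftY-⊛ F G a b (suc c) = Σ-cong a λ i → Σ-cong b λ j → trans (Σ-suc c _)
  (trans (cong (_+ sumTo c (λ k → F i j k * G (a ∸ i) (b ∸ j) (c ∸ k))) (*-zeroˡ (G (a ∸ i) (b ∸ j) (suc c))))
         (+-identityˡ _))

U≋shiftU1ˢ : U ≋ shiftU 1ˢ
U≋shiftU1ˢ zero                b       c       = refl
U≋shiftU1ˢ (suc zero)          zero    zero    = refl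
U≋shiftU1ˢ (suc zero)          zero    (suc c) = refl
U≋shiftU1ˢ (suc zero)          (suc b) c       = refl
U≋shiftU1ˢ (suc (suc a))       b       c       = refl

X≋shiftX1ˢ : X ≋ shiftX 1ˢ
X≋shiftX1ˢ zero    zero             c       = refl
X≋shiftX1ˢ zero    (suc zero)       zero    = refl
X≋shiftX1ˢ zero    (suc zero)       (suc c) = refl
X≋shiftX1ˢ zero    (suc (suc b))    c       = refl
X≋shiftX1ˢ (suc a) zero             c       = refl
X≋shiftX1ˢ (suc a) (suc b)          c       = refl

Y≋shiftY1ˢ : Y ≋ shiftY 1ˢ
Y≋shiftY1ˢ zero    zero    zero             = refl
Y≋shiftY1ˢ zero    zero    (suc zero)       = refl
Y≋shiftY1ˢ zero    zero    (suc (suc c))    = refl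
Y≋shiftY1ˢ zero    (suc b) zero             = refl
Y≋shiftY1ˢ zero    (suc b) (suc c)          = refl
Y≋shiftY1ˢ (suc a) b       zero             = refl
Y≋shiftY1ˢ (suc a) b       (suc c)          = refl

U⊛≋shiftU : ∀ F → U ⊛ F ≋ shiftU F
U⊛≋shiftU F = ≋-trans (⊛-congʳ F U≋shiftU1ˢ) (≋-trans (shiftU-⊛ 1ˢ F) (shiftU-cong (⊛-identityˡ F)))

X⊛≋shiftX : ∀ F → X ⊛ F ≋ shiftX F
X⊛≋shiftX F = ≋-trans (⊛-congʳ F X≋shiftX1ˢ) (≋-trans (shiftX-⊛ 1ˢ F) (shiftX-cong (⊛-identityˡ F)))

Y⊛≋shiftY : ∀ F → Y ⊛ F ≋ shiftY F
Y⊛≋shiftY F = ≋-trans (⊛-congʳ F Y≋shiftY1ˢ) (≋-trans (shiftY-⊛ 1ˢ F) (shiftY-cong (⊛-identityˡ F)))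

∂ : Series → Series
∂ F a b c = ℕtoℚ (suc b) * F a (suc b) c

∂-cong : ∀ {F G} → F ≋ G → ∂ F ≋ ∂ G
∂-cong e a b c = cong (ℕtoℚ (suc b) *_) (e a (suc b) c)

∂-⊕ : ∀ F G → ∂ (F ⊕ G) ≋ ∂ F ⊕ ∂ G
∂-⊕ F G a b c = *-distribˡ-+ (ℕtoℚ (suc b)) (F a (suc b) c) (G a (suc b) c)

∂-ˢ : ∀ F → ∂ (-ˢ F) ≋ -ˢ ∂ F
∂-ˢ F a b c = sym (neg-distribʳ-* (ℕtoℚ (suc b)) (F a (suc b) c))

∂-const : ∀ q → ∂ (const q) ≋ 0ˢ
∂-const q zero    b c = trans (*-zeroʳ (ℕtoℚ (suc b))) (sym (0ˢ-coeff 0 b c))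
∂-const q (suc a) b c = *-zeroʳ (ℕtoℚ (suc b))

∂X≋1ˢ : ∂ X ≋ 1ˢ
∂X≋1ˢ zero    zero    zero    = refl
∂X≋1ˢ zero    zero    (suc c) = *-zeroʳ (ℕtoℚ 1)
∂X≋1ˢ zero    (suc b) c       = *-zeroʳ (ℕtoℚ (suc (suc b)))
∂X≋1ˢ (suc a) b       c       = *-zeroʳ (ℕtoℚ (suc b))

∂U≋0ˢ : ∂ U ≋ 0ˢ
∂U≋0ˢ zero             b c = trans (*-zeroʳ (ℕtoℚ (suc b))) (sym (0ˢ-coeff 0 b c))
∂U≋0ˢ (suc zero)       b c = trans (*-zeroʳ (ℕtoℚ (suc b))) (sym (0ˢ-coeff 1 b c))
∂U≋0ˢ (suc (suc a))    b c = *-zeroʳ (ℕtoℚ (suc b))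

∂Y≋0ˢ : ∂ Y ≋ 0ˢ
∂Y≋0ˢ zero    b c = trans (*-zeroʳ (ℕtoℚ (suc b))) (sym (0ˢ-coeff 0 b c))
∂Y≋0ˢ (suc a) b c = *-zeroʳ (ℕtoℚ (suc b))

-- Leibniz rule for a single convolution: write the factor 1 + b as j + (1 + b - j).
∂-Cauchy : ∀ b (θ : ℕ → ℕ → ℚ) →
  ℕtoℚ (suc b) * sumTo (suc b) (λ j → θ j (suc b ∸ j)) ≡
  sumTo b (λ j → ℕtoℚ (suc j) * θ (suc j) (b ∸ j)) + sumTo b (λ j → ℕtoℚ (suc (b ∸ j)) * θ j (suc (b ∸ j)))
∂-Cauchy b θ = begin
  ℕtoℚ (suc b) * sumTo (suc b) (λ j → θ j (suc b ∸ j))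
    ≡⟨ *-distribˡ-Σ (suc b) (ℕtoℚ (suc b)) _ ⟩
  sumTo (suc b) (λ j → ℕtoℚ (suc b) * θ j (suc b ∸ j))
    ≡⟨ Σ-cong≤ (suc b) split ⟩
  sumTo (suc b) (λ j → ℕtoℚ j * θ j (suc b ∸ j) + ℕtoℚ (suc b ∸ j) * θ j (suc b ∸ j))
    ≡⟨ Σ-distrib-+ (suc b) _ _ ⟩
  sumTo (suc b) (λ j → ℕtoℚ j * θ j (suc b ∸ j)) + sumTo (suc b) (λ j → ℕtoℚ (suc b ∸ j) * θ j (suc b ∸ j))
    ≡⟨ cong₂ _+_ drop-first drop-last ⟩
  sumTo b (λ j → ℕtoℚ (suc j) * θ (suc j) (b ∸ j)) + sumTo b (λ j → ℕtoℚ (suc (b ∸ j)) * θ j (suc (b ∸ j))) ∎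
  where
  open ≡-Reasoning
  split : ∀ j → j ≤ suc b → ℕtoℚ (suc b) * θ j (suc b ∸ j) ≡ ℕtoℚ j * θ j (suc b ∸ j) + ℕtoℚ (suc b ∸ j) * θ j (suc b ∸ j)
  split j j≤1+b = begin
    ℕtoℚ (suc b) * θ j (suc b ∸ j)                 ≡⟨ cong (λ n → ℕtoℚ n * θ j (suc b ∸ j)) (sym (ℕ.m+[n∸m]≡n j≤1+b)) ⟩
    ℕtoℚ (j ℕ.+ (suc b ∸ j)) * θ j (suc b ∸ j)     ≡⟨ cong (_* θ j (suc b ∸ j)) (ℕtoℚ-+ j (suc b ∸ j)) ⟩
    (ℕtoℚ j + ℕtoℚ (suc b ∸ j)) * θ j (suc b ∸ j)  ≡⟨ *-distribʳ-+ (θ j (suc b ∸ j)) (ℕtoℚ j) (ℕtoℚ (suc b ∸ j)) ⟩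
    ℕtoℚ j * θ j (suc b ∸ j) + ℕtoℚ (suc b ∸ j) * θ j (suc b ∸ j) ∎
  drop-first : sumTo (suc b) (λ j → ℕtoℚ j * θ j (suc b ∸ j)) ≡ sumTo b (λ j → ℕtoℚ (suc j) * θ (suc j) (b ∸ j))
  drop-first = trans (Σ-suc b _) (trans (cong (_+ rest) (*-zeroˡ (θ 0 (suc b)))) (+-identityˡ rest))
    where
    rest : ℚ
    rest = sumTo b (λ j → ℕtoℚ (suc j) * θ (suc j) (b ∸ j))
  drop-last : sumTo (suc b) (λ j → ℕtoℚ (suc b ∸ j) * θ j (suc b ∸ j)) ≡ sumTo b (λ j → ℕtoℚ (suc (b ∸ j)) * θ j (suc (b ∸ j)))
  drop-last = trans (cong₂ _+_ (Σ-cong≤ b (λ j j≤b → cong (λ n → ℕtoℚ n * θ j n) (ℕ.+-∸-assoc 1 j≤b)))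
                               (trans (cong (λ n → ℕtoℚ n * θ (suc b) n) (ℕ.n∸n≡0 b)) (*-zeroˡ (θ (suc b) 0))))
                    (+-identityʳ _)

∂-⊛ : ∀ F G → ∂ (F ⊛ G) ≋ ∂ F ⊛ G ⊕ F ⊛ ∂ G
∂-⊛ F G a b c = begin
  ℕtoℚ (suc b) * sumTo a (λ i → sumTo (suc b) (λ j → θ i j (suc b ∸ j)))
    ≡⟨ *-distribˡ-Σ a (ℕtoℚ (suc b)) _ ⟩
  sumTo a (λ i → ℕtoℚ (suc b) * sumTo (suc b) (λ j → θ i j (suc b ∸ j)))
    ≡⟨ Σ-cong a (λ i → ∂-Cauchy b (θ i)) ⟩
  sumTo a (λ i → sumTo b (λ j → ℕtoℚ (suc j) * θ i (suc j) (b ∸ j)) + sumTo b (λ j → ℕtoℚ (suc (b ∸ j)) * θ i j (suc (b ∸ j))))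
    ≡⟨ Σ-distrib-+ a _ _ ⟩
  sumTo a (λ i → sumTo b (λ j → ℕtoℚ (suc j) * θ i (suc j) (b ∸ j))) + sumTo a (λ i → sumTo b (λ j → ℕtoℚ (suc (b ∸ j)) * θ i j (suc (b ∸ j))))
    ≡⟨ cong₂ _+_ (Σ-cong a λ i → Σ-cong b λ j → trans (*-distribˡ-Σ c (ℕtoℚ (suc j)) _) (Σ-cong c λ k →
                   sym (*-assoc (ℕtoℚ (suc j)) (F i (suc j) k) (G (a ∸ i) (b ∸ j) (c ∸ k)))))
                 (Σ-cong a λ i → Σ-cong b λ j → trans (*-distribˡ-Σ c (ℕtoℚ (suc (b ∸ j))) _) (Σ-cong c λ k →
                   x∙yz≈y∙xz (ℕtoℚ (suc (b ∸ j))) (F i j k) (G (a ∸ i) (suc (b ∸ j)) (c ∸ k)))) ⟩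
  (∂ F ⊛ G ⊕ F ⊛ ∂ G) a b c ∎
  where
  open ≡-Reasoning
  θ : ℕ → ℕ → ℕ → ℚ
  θ i j j′ = sumTo c (λ k → F i j k * G (a ∸ i) j′ (c ∸ k))

record XFree (P : Series) : Set where
  constructor xfree
  field ∂≋0ˢ : ∂ P ≋ 0ˢ

∂-X⊛ : ∀ {P} → XFree P → ∂ (X ⊛ P) ≋ P
∂-X⊛ {P} (xfree ∂P≋0) = begin
  ∂ (X ⊛ P)            ≈⟨ ∂-⊛ X P ⟩
  ∂ X ⊛ P ⊕ X ⊛ ∂ P    ≈⟨ ⊕-cong (⊛-congʳ P ∂X≋1ˢ) (⊛-congˡ X ∂P≋0) ⟩
  1ˢ ⊛ P ⊕ X ⊛ 0ˢ      ≈⟨ solve 2 (λ x p → con 1ℚ :* p :+ x :* con 0ℚ := p) ≋-refl X P ⟩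
  P                    ∎
  where
  open ≋-Reasoning
  open ˢ-Solver

XFree-const : ∀ q → XFree (const q)
XFree-const q = xfree (∂-const q)

XFree-U : XFree U
XFree-U = xfree ∂U≋0ˢ

XFree-Y : XFree Y
XFree-Y = xfree ∂Y≋0ˢ

XFree-⊕ : ∀ {P Q} → XFree P → XFree Q → XFree (P ⊕ Q)
XFree-⊕ {P} {Q} (xfree ∂P≋0) (xfree ∂Q≋0) = xfree (begin
  ∂ (P ⊕ Q)    ≈⟨ ∂-⊕ P Q ⟩
  ∂ P ⊕ ∂ Q    ≈⟨ ⊕-cong ∂P≋0 ∂Q≋0 ⟩
  0ˢ ⊕ 0ˢ      ≈⟨ solve 0 (con 0ℚ :+ con 0ℚ := con 0ℚ) ≋-refl ⟩
  0ˢ           ∎)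
  where
  open ≋-Reasoning
  open ˢ-Solver

XFree-⊛ : ∀ {P Q} → XFree P → XFree Q → XFree (P ⊛ Q)
XFree-⊛ {P} {Q} (xfree ∂P≋0) (xfree ∂Q≋0) = xfree (begin
  ∂ (P ⊛ Q)             ≈⟨ ∂-⊛ P Q ⟩
  ∂ P ⊛ Q ⊕ P ⊛ ∂ Q     ≈⟨ ⊕-cong (⊛-congʳ Q ∂P≋0) (⊛-congˡ P ∂Q≋0) ⟩
  0ˢ ⊛ Q ⊕ P ⊛ 0ˢ       ≈⟨ solve 2 (λ p q → con 0ℚ :* q :+ p :* con 0ℚ := con 0ℚ) ≋-refl P Q ⟩
  0ˢ                    ∎)
  where
  open ≋-Reasoning
  open ˢ-Solver

-- Substitution into a power series

record NoConst (G : Series) : Set where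
  constructor noConst
  field coeff₀₀≡0 : ∀ a → G a 0 0 ≡ 0ℚ
open NoConst

NoConst-X⊛ : ∀ F → NoConst (X ⊛ F)
NoConst-X⊛ F = noConst λ a → X⊛≋shiftX F a 0 0

NoConst-Y : NoConst Y
NoConst-Y = noConst λ { zero → refl ; (suc a) → refl }

NoConst-⊕ : ∀ {F G} → NoConst F → NoConst G → NoConst (F ⊕ G)
NoConst-⊕ (noConst F₀) (noConst G₀) = noConst λ a → trans (cong₂ _+_ (F₀ a) (G₀ a)) (+-identityʳ 0ℚ)

NoConst-ˢ : ∀ {F} → NoConst F → NoConst (-ˢ F)
NoConst-ˢ (noConst F₀) = noConst λ a → cong -_ (F₀ a)

NoConst-⊛ : ∀ {F} G → NoConst F → NoConst (F ⊛ G)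
NoConst-⊛ {F} G (noConst F₀) = noConst λ a → Σ-zero a λ i _ → trans (cong (_* G (a ∸ i) 0 0) (F₀ i)) (*-zeroˡ (G (a ∸ i) 0 0))

^ˢ-vanishes : ∀ {G} → NoConst G → ∀ j a b c → b ℕ.+ c < j → (G ^ˢ j) a b c ≡ 0ℚ
^ˢ-vanishes {G} G₀ (suc j) a b c b+c<1+j = Σ³-zero a b c term≡0
  where
  term≡0 : ∀ i k l → i ≤ a → k ≤ b → l ≤ c → G i k l * (G ^ˢ j) (a ∸ i) (b ∸ k) (c ∸ l) ≡ 0ℚ
  term≡0 i zero zero _ _ _ = trans (cong (_* (G ^ˢ j) (a ∸ i) b c) (coeff₀₀≡0 G₀ i)) (*-zeroˡ ((G ^ˢ j) (a ∸ i) b c))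
  term≡0 i (suc k) l _ 1+k≤b _ = trans (cong (G i (suc k) l *_) (^ˢ-vanishes G₀ j (a ∸ i) (b ∸ suc k) (c ∸ l) (lower-x b 1+k≤b b+c<1+j)))
                                       (*-zeroʳ (G i (suc k) l))
    where
    lower-x : ∀ b → suc k ≤ b → b ℕ.+ c < suc j → (b ∸ suc k) ℕ.+ (c ∸ l) < j
    lower-x (suc b) _ (s≤s b+c<j) = ℕ.≤-<-trans (ℕ.+-mono-≤ (ℕ.m∸n≤m b k) (ℕ.m∸n≤m c l)) b+c<j
  term≡0 i zero (suc l) _ _ 1+l≤c = trans (cong (G i zero (suc l) *_) (^ˢ-vanishes G₀ j (a ∸ i) b (c ∸ suc l) (lower-y c 1+l≤c b+c<1+j)))
                                          (*-zeroʳ (G i zero (suc l)))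
    where
    lower-y : ∀ c → suc l ≤ c → b ℕ.+ c < suc j → b ℕ.+ (c ∸ suc l) < j
    lower-y (suc c) _ b+1+c<1+j = ℕ.≤-<-trans (ℕ.+-monoʳ-≤ b (ℕ.m∸n≤m c l))
                                              (ℕ.≤-pred (ℕ.≤-trans (ℕ.≤-reflexive (cong suc (sym (ℕ.+-suc b c)))) b+1+c<1+j))

subst-extend : ∀ {G} → NoConst G → ∀ cs N a b c → b ℕ.+ c ≤ N →
               sumTo N (λ j → cs j * (G ^ˢ j) a b c) ≡ subst cs G a b c
subst-extend {G} G₀ cs N a b c b+c≤N =
  Σ-extend (b ℕ.+ c) N b+c≤N (λ j b+c<j _ → trans (cong (cs j *_) (^ˢ-vanishes G₀ j a b c b+c<j)) (*-zeroʳ (cs j)))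

⊛-subst : ∀ {G} → NoConst G → ∀ cs F a b c →
          (F ⊛ subst cs G) a b c ≡ sumTo (b ℕ.+ c) (λ j → cs j * (F ⊛ G ^ˢ j) a b c)
⊛-subst {G} G₀ cs F a b c = begin
  Σ³ a b c (λ i k l → F i k l * subst cs G (a ∸ i) (b ∸ k) (c ∸ l))
    ≡⟨ Σ³-cong≤ a b c (λ i k l _ k≤b l≤c → cong (F i k l *_) (sym (subst-extend G₀ cs (b ℕ.+ c) (a ∸ i) (b ∸ k) (c ∸ l)
         (ℕ.+-mono-≤ (ℕ.m∸n≤m b k) (ℕ.m∸n≤m c l))))) ⟩
  Σ³ a b c (λ i k l → F i k l * sumTo (b ℕ.+ c) (λ j → cs j * (G ^ˢ j) (a ∸ i) (b ∸ k) (c ∸ l)))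
    ≡⟨ Σ³-cong a b c (λ i k l → trans (*-distribˡ-Σ (b ℕ.+ c) (F i k l) _) (Σ-cong (b ℕ.+ c) λ j →
         x∙yz≈y∙xz (F i k l) (cs j) ((G ^ˢ j) (a ∸ i) (b ∸ k) (c ∸ l)))) ⟩
  Σ³ a b c (λ i k l → sumTo (b ℕ.+ c) (λ j → cs j * (F i k l * (G ^ˢ j) (a ∸ i) (b ∸ k) (c ∸ l))))
    ≡⟨ Σ³-comm-Σ (b ℕ.+ c) a b c _ ⟩
  sumTo (b ℕ.+ c) (λ j → Σ³ a b c (λ i k l → cs j * (F i k l * (G ^ˢ j) (a ∸ i) (b ∸ k) (c ∸ l))))
    ≡⟨ Σ-cong (b ℕ.+ c) (λ j → sym (*-distribˡ-Σ³ a b c (cs j) _)) ⟩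
  sumTo (b ℕ.+ c) (λ j → cs j * (F ⊛ G ^ˢ j) a b c) ∎
  where
  open ≡-Reasoning

^ˢ-cong : ∀ {G G′} → G ≋ G′ → ∀ j → G ^ˢ j ≋ G′ ^ˢ j
^ˢ-cong e zero    = ≋-refl
^ˢ-cong e (suc j) = ⊛-cong e (^ˢ-cong e j)

subst-cong : ∀ {cs ds G G′} → (∀ j → cs j ≡ ds j) → G ≋ G′ → subst cs G ≋ subst ds G′
subst-cong cs≗ds G≋G′ a b c = Σ-cong (b ℕ.+ c) λ j → cong₂ _*_ (cs≗ds j) (^ˢ-cong G≋G′ j a b c)

expS-cong : ∀ {G G′} → G ≋ G′ → expS G ≋ expS G′
expS-cong = subst-cong {inv!} {inv!} (λ _ → refl)

inv1m-cong : ∀ {G G′} → G ≋ G′ → inv1m G ≋ inv1m G′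
inv1m-cong = subst-cong {λ _ → 1ℚ} {λ _ → 1ℚ} (λ _ → refl)

pow1p-cong : ∀ α {G G′} → G ≋ G′ → pow1p α G ≋ pow1p α G′
pow1p-cong α = subst-cong {gbinom α} {gbinom α} (λ _ → refl)

subst-⊕ : ∀ cs ds G → subst (λ j → cs j + ds j) G ≋ subst cs G ⊕ subst ds G
subst-⊕ cs ds G a b c =
  trans (Σ-cong (b ℕ.+ c) (λ j → *-distribʳ-+ ((G ^ˢ j) a b c) (cs j) (ds j))) (Σ-distrib-+ (b ℕ.+ c) _ _)

subst-· : ∀ q cs G → subst (λ j → q * cs j) G ≋ q · subst cs G
subst-· q cs G a b c =
  trans (Σ-cong (b ℕ.+ c) (λ j → *-assoc q (cs j) ((G ^ˢ j) a b c))) (sym (*-distribˡ-Σ (b ℕ.+ c) q _))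

δ₀ : ℕ → ℚ
δ₀ zero    = 1ℚ
δ₀ (suc _) = 0ℚ

subst-δ₀ : ∀ G → subst δ₀ G ≋ 1ˢ
subst-δ₀ G a b c = trans (Σ-single (b ℕ.+ c) 0 z≤n higher≡0) (*-identityˡ (1ˢ a b c))
  where
  higher≡0 : ∀ j → j ≤ b ℕ.+ c → j ≢ 0 → δ₀ j * (G ^ˢ j) a b c ≡ 0ℚ
  higher≡0 zero    _ j≢0 = ⊥-elim (j≢0 refl)
  higher≡0 (suc j) _ _   = *-zeroˡ ((G ^ˢ suc j) a b c)

0∷_ : (ℕ → ℚ) → ℕ → ℚ
(0∷ cs) zero    = 0ℚ
(0∷ cs) (suc j) = cs j

subst-0∷ : ∀ {G} → NoConst G → ∀ cs → subst (0∷ cs) G ≋ G ⊛ subst cs G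
subst-0∷ {G} G₀ cs a b c = begin
  subst (0∷ cs) G a b c
    ≡⟨ sym (subst-extend G₀ (0∷ cs) (suc (b ℕ.+ c)) a b c (ℕ.n≤1+n _)) ⟩
  sumTo (suc (b ℕ.+ c)) (λ j → (0∷ cs) j * (G ^ˢ j) a b c)
    ≡⟨ Σ-suc (b ℕ.+ c) _ ⟩
  0ℚ * 1ˢ a b c + sumTo (b ℕ.+ c) (λ j → cs j * (G ^ˢ suc j) a b c)
    ≡⟨ cong (_+ sumTo (b ℕ.+ c) (λ j → cs j * (G ^ˢ suc j) a b c)) (*-zeroˡ (1ˢ a b c)) ⟩
  0ℚ + sumTo (b ℕ.+ c) (λ j → cs j * (G ^ˢ suc j) a b c)
    ≡⟨ +-identityˡ _ ⟩
  sumTo (b ℕ.+ c) (λ j → cs j * (G ^ˢ suc j) a b c)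
    ≡⟨ sym (⊛-subst G₀ cs G a b c) ⟩
  (G ⊛ subst cs G) a b c ∎
  where
  open ≡-Reasoning

∂-^ˢ : ∀ G j → ∂ (G ^ˢ suc j) ≋ ℕtoℚ (suc j) · (∂ G ⊛ G ^ˢ j)
∂-^ˢ G zero = begin
  ∂ (G ⊛ 1ˢ)                 ≈⟨ ∂-⊛ G 1ˢ ⟩
  ∂ G ⊛ 1ˢ ⊕ G ⊛ ∂ 1ˢ        ≈⟨ ⊕-congˡ (∂ G ⊛ 1ˢ) (⊛-congˡ G (∂-const 1ℚ)) ⟩
  ∂ G ⊛ 1ˢ ⊕ G ⊛ 0ˢ          ≈⟨ solve 2 (λ g g′ → g′ :* con 1ℚ :+ g :* con 0ℚ := con 1ℚ :* (g′ :* con 1ℚ)) ≋-refl G (∂ G) ⟩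
  const 1ℚ ⊛ (∂ G ⊛ 1ˢ)      ≈⟨ ≋-sym (·≋const⊛ 1ℚ (∂ G ⊛ 1ˢ)) ⟩
  1ℚ · (∂ G ⊛ 1ˢ)            ∎
  where
  open ≋-Reasoning
  open ˢ-Solver
∂-^ˢ G (suc j) = begin
  ∂ (G ⊛ G ^ˢ suc j)                          ≈⟨ ∂-⊛ G (G ^ˢ suc j) ⟩
  ∂ G ⊛ G ^ˢ suc j ⊕ G ⊛ ∂ (G ^ˢ suc j)       ≈⟨ ⊕-congˡ (∂ G ⊛ G ^ˢ suc j) 
                                                        (⊛-congˡ G (≋-trans (∂-^ˢ G j) (·≋const⊛ n (∂ G ⊛ G ^ˢ j)))) ⟩
  ∂ G ⊛ G ^ˢ suc j ⊕ G ⊛ (const n ⊛ (∂ G ⊛ G ^ˢ j))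
    ≈⟨ solve 4 (λ g g′ p n → g′ :* (g :* p) :+ g :* (n :* (g′ :* p)) := (con 1ℚ :+ n) :* (g′ :* (g :* p))) ≋-refl
             G (∂ G) (G ^ˢ j) (const n) ⟩
  (1ˢ ⊕ const n) ⊛ (∂ G ⊛ G ^ˢ suc j)         ≈⟨ ⊛-congʳ (∂ G ⊛ G ^ˢ suc j) (const-+ 1ℚ n) ⟨
  const (1ℚ + n) ⊛ (∂ G ⊛ G ^ˢ suc j)         ≈⟨ ⊛-congʳ (∂ G ⊛ G ^ˢ suc j) (≡⇒≋ (cong const (ℕtoℚ-+ 1 (suc j)))) ⟨
  const (ℕtoℚ (suc (suc j))) ⊛ (∂ G ⊛ G ^ˢ suc j)  ≈⟨ ≋-sym (·≋const⊛ _ (∂ G ⊛ G ^ˢ suc j)) ⟩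
  ℕtoℚ (suc (suc j)) · (∂ G ⊛ G ^ˢ suc j)     ∎
  where
  open ≋-Reasoning
  open ˢ-Solver
  n : ℚ
  n = ℕtoℚ (suc j)

∂-subst : ∀ {G} → NoConst G → ∀ cs → ∂ (subst cs G) ≋ ∂ G ⊛ subst (λ j → ℕtoℚ (suc j) * cs (suc j)) G
∂-subst {G} G₀ cs a b c = begin
  ℕtoℚ (suc b) * sumTo (suc (b ℕ.+ c)) (λ j → cs j * (G ^ˢ j) a (suc b) c)
    ≡⟨ *-distribˡ-Σ (suc (b ℕ.+ c)) (ℕtoℚ (suc b)) _ ⟩
  sumTo (suc (b ℕ.+ c)) (λ j → ℕtoℚ (suc b) * (cs j * (G ^ˢ j) a (suc b) c))
    ≡⟨ Σ-cong (suc (b ℕ.+ c)) (λ j → x∙yz≈y∙xz (ℕtoℚ (suc b)) (cs j) ((G ^ˢ j) a (suc b) c)) ⟩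
  sumTo (suc (b ℕ.+ c)) (λ j → cs j * ∂ (G ^ˢ j) a b c)
    ≡⟨ Σ-suc (b ℕ.+ c) _ ⟩
  cs 0 * ∂ 1ˢ a b c + sumTo (b ℕ.+ c) (λ j → cs (suc j) * ∂ (G ^ˢ suc j) a b c)
    ≡⟨ cong₂ _+_ (trans (cong (cs 0 *_) (trans (∂-const 1ℚ a b c) (0ˢ-coeff a b c))) (*-zeroʳ (cs 0)))
                 (Σ-cong (b ℕ.+ c) (λ j → trans (cong (cs (suc j) *_) (∂-^ˢ G j a b c))
                   (x∙yz≈yx∙z (cs (suc j)) (ℕtoℚ (suc j)) ((∂ G ⊛ G ^ˢ j) a b c)))) ⟩
  0ℚ + sumTo (b ℕ.+ c) (λ j → ℕtoℚ (suc j) * cs (suc j) * (∂ G ⊛ G ^ˢ j) a b c)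
    ≡⟨ +-identityˡ _ ⟩
  sumTo (b ℕ.+ c) (λ j → ℕtoℚ (suc j) * cs (suc j) * (∂ G ⊛ G ^ˢ j) a b c)
    ≡⟨ sym (⊛-subst G₀ (λ j → ℕtoℚ (suc j) * cs (suc j)) (∂ G) a b c) ⟩
  (∂ G ⊛ subst (λ j → ℕtoℚ (suc j) * cs (suc j)) G) a b c ∎
  where
  open ≡-Reasoning

∂-expS : ∀ {G} → NoConst G → ∂ (expS G) ≋ ∂ G ⊛ expS G
∂-expS {G} G₀ = ≋-trans (∂-subst G₀ inv!) (⊛-congˡ (∂ G) (subst-cong ℕtoℚ[1+n]*inv![1+n]≡inv!n (≋-refl {G})))

inv1m-unfold : ∀ {G} → NoConst G → inv1m G ≋ 1ˢ ⊕ G ⊛ inv1m G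
inv1m-unfold {G} G₀ = begin
  inv1m G                                  ≈⟨ subst-cong δ₀+0∷1≡1 (≋-refl {G}) ⟨
  subst (λ j → δ₀ j + (0∷ λ _ → 1ℚ) j) G   ≈⟨ subst-⊕ δ₀ (0∷ λ _ → 1ℚ) G ⟩
  subst δ₀ G ⊕ subst (0∷ λ _ → 1ℚ) G       ≈⟨ ⊕-cong (subst-δ₀ G) (subst-0∷ G₀ (λ _ → 1ℚ)) ⟩
  1ˢ ⊕ G ⊛ inv1m G                         ∎
  where
  open ≋-Reasoning
  δ₀+0∷1≡1 : ∀ j → δ₀ j + (0∷ λ _ → 1ℚ) j ≡ 1ℚ
  δ₀+0∷1≡1 zero    = refl
  δ₀+0∷1≡1 (suc j) = refl

falling : ℚ → ℕ → ℚ
falling α j = prodBelow j (λ i → α - ℕtoℚ i)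

falling-suc : ∀ α j → falling α (suc j) ≡ α * falling (α - 1ℚ) j
falling-suc α zero    = solve 1 (λ α → con 1ℚ :* (α :- con 0ℚ) := α :* con 1ℚ) refl α
  where
  open ℚ-Solver
falling-suc α (suc j) = begin
  falling α (suc j) * (α - ℕtoℚ (suc j))          ≡⟨ cong (_* (α - ℕtoℚ (suc j))) (falling-suc α j) ⟩
  α * falling (α - 1ℚ) j * (α - ℕtoℚ (suc j))     ≡⟨ cong (λ n → α * falling (α - 1ℚ) j * (α - n)) (ℕtoℚ-+ 1 j) ⟩
  α * falling (α - 1ℚ) j * (α - (1ℚ + ℕtoℚ j))
    ≡⟨ solve 3 (λ α p n → α :* p :* (α :- (con 1ℚ :+ n)) := α :* (p :* ((α :- con 1ℚ) :- n))) refl α (falling (α - 1ℚ) j) (ℕtoℚ j) ⟩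
  α * falling (α - 1ℚ) (suc j)                    ∎
  where
  open ℚ-Solver
  open ≡-Reasoning

gbinom-absorb : ∀ α j → ℕtoℚ (suc j) * gbinom α (suc j) ≡ α * gbinom (α - 1ℚ) j
gbinom-absorb α j = begin
  ℕtoℚ (suc j) * (falling α (suc j) * inv! (suc j))        ≡⟨ cong (λ p → ℕtoℚ (suc j) * (p * inv! (suc j))) (falling-suc α j) ⟩
  ℕtoℚ (suc j) * (α * falling (α - 1ℚ) j * inv! (suc j))
    ≡⟨ solve 4 (λ n α p w → n :* (α :* p :* w) := α :* (p :* (n :* w))) refl (ℕtoℚ (suc j)) α (falling (α - 1ℚ) j) (inv! (suc j)) ⟩
  α * (falling (α - 1ℚ) j * (ℕtoℚ (suc j) * inv! (suc j))) ≡⟨ cong (λ w → α * (falling (α - 1ℚ) j * w)) (ℕtoℚ[1+n]*inv![1+n]≡inv!n j) ⟩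
  α * gbinom (α - 1ℚ) j                                    ∎
  where
  open ℚ-Solver
  open ≡-Reasoning

gbinom-pascal : ∀ α j → gbinom α j ≡ gbinom (α - 1ℚ) j + (0∷ gbinom (α - 1ℚ)) j
gbinom-pascal α zero    = sym (+-identityʳ (gbinom (α - 1ℚ) 0))
gbinom-pascal α (suc j) = begin
  falling α (suc j) * inv! (suc j)                 ≡⟨ cong (_* inv! (suc j)) (falling-suc α j) ⟩
  α * p * inv! (suc j)
    ≡⟨ solve 4 (λ α p n w → α :* p :* w := p :* ((α :- con 1ℚ) :- n) :* w :+ p :* ((con 1ℚ :+ n) :* w)) refl α p (ℕtoℚ j) (inv! (suc j)) ⟩
  gbinom (α - 1ℚ) (suc j) + p * ((1ℚ + ℕtoℚ j) * inv! (suc j))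
    ≡⟨ cong (λ n → gbinom (α - 1ℚ) (suc j) + p * (n * inv! (suc j))) (sym (ℕtoℚ-+ 1 j)) ⟩
  gbinom (α - 1ℚ) (suc j) + p * (ℕtoℚ (suc j) * inv! (suc j))
    ≡⟨ cong (λ w → gbinom (α - 1ℚ) (suc j) + p * w) (ℕtoℚ[1+n]*inv![1+n]≡inv!n j) ⟩
  gbinom (α - 1ℚ) (suc j) + gbinom (α - 1ℚ) j      ∎
  where
  open ℚ-Solver
  open ≡-Reasoning
  p : ℚ
  p = falling (α - 1ℚ) j

∂-pow1p : ∀ {H} → NoConst H → ∀ α → (1ˢ ⊕ H) ⊛ ∂ (pow1p α H) ≋ const α ⊛ (∂ H ⊛ pow1p α H)
∂-pow1p {H} H₀ α = begin
  (1ˢ ⊕ H) ⊛ ∂ (pow1p α H)           ≈⟨ ⊛-congˡ (1ˢ ⊕ H) ∂S≋∂H⊛α⊛S′ ⟩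
  (1ˢ ⊕ H) ⊛ (∂ H ⊛ (const α ⊛ S′))   ≈⟨ solve 4 (λ h h′ a t → (con 1ℚ :+ h) :* (h′ :* (a :* t)) := a :* (h′ :* (t :+ h :* t))) ≋-refl
                                                H (∂ H) (const α) S′ ⟩
  const α ⊛ (∂ H ⊛ (S′ ⊕ H ⊛ S′))      ≈⟨ ⊛-congˡ (const α) (⊛-congˡ (∂ H) S≋S′⊕H⊛S′) ⟨
  const α ⊛ (∂ H ⊛ pow1p α H)        ∎
  where
  open ≋-Reasoning
  open ˢ-Solver
  S′ : Series
  S′ = pow1p (α - 1ℚ) H
  ∂S≋∂H⊛α⊛S′ : ∂ (pow1p α H) ≋ ∂ H ⊛ (const α ⊛ S′)
  ∂S≋∂H⊛α⊛S′ = begin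
    ∂ (pow1p α H)                                          ≈⟨ ∂-subst H₀ (gbinom α) ⟩
    ∂ H ⊛ subst (λ j → ℕtoℚ (suc j) * gbinom α (suc j)) H  ≈⟨ ⊛-congˡ (∂ H) (subst-cong (gbinom-absorb α) (≋-refl {H})) ⟩
    ∂ H ⊛ subst (λ j → α * gbinom (α - 1ℚ) j) H            ≈⟨ ⊛-congˡ (∂ H) (≋-trans (subst-· α (gbinom (α - 1ℚ)) H) (·≋const⊛ α S′)) ⟩
    ∂ H ⊛ (const α ⊛ S′)                                    ∎
  S≋S′⊕H⊛S′ : pow1p α H ≋ S′ ⊕ H ⊛ S′
  S≋S′⊕H⊛S′ = begin
    pow1p α H                                                         ≈⟨ subst-cong (gbinom-pascal α) (≋-refl {H}) ⟩
    subst (λ j → gbinom (α - 1ℚ) j + (0∷ gbinom (α - 1ℚ)) j) H        ≈⟨ subst-⊕ (gbinom (α - 1ℚ)) (0∷ gbinom (α - 1ℚ)) H ⟩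
    S′ ⊕ subst (0∷ gbinom (α - 1ℚ)) H                                  ≈⟨ ⊕-congˡ S′ (subst-0∷ H₀ (gbinom (α - 1ℚ))) ⟩
    S′ ⊕ H ⊛ S′                                                         ∎

module _ {K} (K-xfree : XFree K) where

  private
    D A : Series
    D = 1ˢ ⊖ X ⊛ K
    A = inv1m (X ⊛ K)

  D⊛inv1m : D ⊛ A ≋ 1ˢ
  D⊛inv1m = fixpoint-elim {K = K} (≋-trans (inv1m-unfold (NoConst-X⊛ K))
    (solve 3 (λ x k a → con 1ℚ :+ x :* k :* a := con 1ℚ :+ x :* (k :* a)) ≋-refl X K A))
    where
    open ˢ-Solver

  D⊛∂inv1m : D ⊛ ∂ A ≋ K ⊛ A
  D⊛∂inv1m = fixpoint-elim {K = K} (begin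
    ∂ A                                   ≈⟨ ∂-cong (inv1m-unfold (NoConst-X⊛ K)) ⟩
    ∂ (1ˢ ⊕ X ⊛ K ⊛ A)                    ≈⟨ ≋-trans (∂-⊕ 1ˢ (X ⊛ K ⊛ A)) (⊕-cong (∂-const 1ℚ) (∂-⊛ (X ⊛ K) A)) ⟩
    0ˢ ⊕ (∂ (X ⊛ K) ⊛ A ⊕ X ⊛ K ⊛ ∂ A)   ≈⟨ ⊕-congˡ 0ˢ (⊕-congʳ (X ⊛ K ⊛ ∂ A) (⊛-congʳ A (∂-X⊛ {K} K-xfree))) ⟩
    0ˢ ⊕ (K ⊛ A ⊕ X ⊛ K ⊛ ∂ A)
      ≈⟨ solve 4 (λ x k a a′ → con 0ℚ :+ (k :* a :+ x :* k :* a′) := k :* a :+ x :* (k :* a′)) ≋-refl X K A (∂ A) ⟩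
    K ⊛ A ⊕ X ⊛ (K ⊛ ∂ A)                ∎)
    where
    open ≋-Reasoning
    open ˢ-Solver

  D²∂inv1m : D ⊛ (D ⊛ ∂ A) ≋ (K ⊛ D) ⊛ A
  D²∂inv1m = begin
    D ⊛ (D ⊛ ∂ A)   ≈⟨ ⊛-congˡ D D⊛∂inv1m ⟩
    D ⊛ (K ⊛ A)     ≈⟨ solve 3 (λ x k a → (con 1ℚ :- x :* k) :* (k :* a) := (k :* (con 1ℚ :- x :* k)) :* a) ≋-refl X K A ⟩
    (K ⊛ D) ⊛ A     ∎
    where
    open ≋-Reasoning
    open ˢ-Solver

  D²∂[N⊛inv1m] : ∀ N → D ⊛ (D ⊛ ∂ (N ⊛ A)) ≋ ∂ N ⊛ D ⊕ N ⊛ K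
  D²∂[N⊛inv1m] N = begin
    D ⊛ (D ⊛ ∂ (N ⊛ A))                     ≈⟨ ⊛-congˡ D (⊛-congˡ D (∂-⊛ N A)) ⟩
    D ⊛ (D ⊛ (∂ N ⊛ A ⊕ N ⊛ ∂ A))
      ≈⟨ solve 6 (λ x k n n′ a a′ → d x k :* (d x k :* (n′ :* a :+ n :* a′)) := n′ :* (d x k :* (d x k :* a)) :+ n :* (d x k :* (d x k :* a′)))
               ≋-refl X K N (∂ N) A (∂ A) ⟩
    ∂ N ⊛ (D ⊛ (D ⊛ A)) ⊕ N ⊛ (D ⊛ (D ⊛ ∂ A)) ≈⟨ ⊕-cong (⊛-congˡ (∂ N) (⊛-congˡ D D⊛inv1m))
                                                        (⊛-congˡ N (⊛-congˡ D D⊛∂inv1m)) ⟩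
    ∂ N ⊛ (D ⊛ 1ˢ) ⊕ N ⊛ (D ⊛ (K ⊛ A))
      ≈⟨ solve 5 (λ x k n n′ a → n′ :* (d x k :* con 1ℚ) :+ n :* (d x k :* (k :* a)) := n′ :* d x k :+ n :* (k :* (d x k :* a)))
               ≋-refl X K N (∂ N) A ⟩
    ∂ N ⊛ D ⊕ N ⊛ (K ⊛ (D ⊛ A))              ≈⟨ ⊕-congˡ (∂ N ⊛ D) (⊛-congˡ N (⊛-congˡ K D⊛inv1m)) ⟩
    ∂ N ⊛ D ⊕ N ⊛ (K ⊛ 1ˢ)                   ≈⟨ solve 5 (λ x k n n′ a → n′ :* d x k :+ n :* (k :* con 1ℚ) := n′ :* d x k :+ n :* k)
                                                        ≋-refl X K N (∂ N) A ⟩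
    ∂ N ⊛ D ⊕ N ⊛ K                          ∎
    where
    open ≋-Reasoning
    open ˢ-Solver
    d : ∀ {n} → Polynomial n → Polynomial n → Polynomial n
    d x k = con 1ℚ :- x :* k

infix 4 _≈₀_
record _≈₀_ (F G : Series) : Set where
  constructor agree₀
  field coeff₀ : ∀ a c → F a 0 c ≡ G a 0 c
open _≈₀_

≈₀-setoid : Setoid 0ℓ 0ℓ
≈₀-setoid = record
  { Carrier = Series ; _≈_ = _≈₀_
  ; isEquivalence = record
    { refl  = agree₀ λ a c → refl
    ; sym   = λ (agree₀ e) → agree₀ λ a c → sym (e a c)
    ; trans = λ (agree₀ e) (agree₀ f) → agree₀ λ a c → trans (e a c) (f a c) } }

module ≈₀-Reasoning = SetoidReasoning ≈₀-setoid
open Setoid ≈₀-setoid public using () renaming (sym to ≈₀-sym; trans to ≈₀-trans)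

≋⇒≈₀ : ∀ {F G} → F ≋ G → F ≈₀ G
≋⇒≈₀ F≋G = agree₀ λ a c → F≋G a 0 c

⊛-cong₀ : ∀ {F F′ G G′} → F ≈₀ F′ → G ≈₀ G′ → F ⊛ G ≈₀ F′ ⊛ G′
⊛-cong₀ (agree₀ e) (agree₀ f) = agree₀ λ a c → Σ-cong a λ i → Σ-cong c λ k → cong₂ _*_ (e i k) (f (a ∸ i) (c ∸ k))

subst-cong₀ : ∀ cs {G G′} → G ≈₀ G′ → subst cs G ≈₀ subst cs G′
subst-cong₀ cs {G} {G′} e = agree₀ λ a c → Σ-cong c λ j → cong (cs j *_) (coeff₀ (^ˢ-cong₀ j) a c)
  where
  ^ˢ-cong₀ : ∀ j → G ^ˢ j ≈₀ G′ ^ˢ j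
  ^ˢ-cong₀ zero    = agree₀ λ a c → refl
  ^ˢ-cong₀ (suc j) = ⊛-cong₀ e (^ˢ-cong₀ j)

X⊛≈₀0ˢ : ∀ F → X ⊛ F ≈₀ 0ˢ
X⊛≈₀0ˢ F = agree₀ λ a c → trans (X⊛≋shiftX F a 0 c) (sym (0ˢ-coeff a 0 c))

X⊛F⊕G≈₀G : ∀ F G → X ⊛ F ⊕ G ≈₀ G
X⊛F⊕G≈₀G F G = agree₀ λ a c → trans (cong (_+ G a 0 c) (X⊛≋shiftX F a 0 c)) (+-identityˡ (G a 0 c))

subst-0ˢ : ∀ cs → subst cs 0ˢ ≋ cs 0 · 1ˢ
subst-0ˢ cs a b c = Σ-single (b ℕ.+ c) 0 z≤n higher≡0
  where
  higher≡0 : ∀ j → j ≤ b ℕ.+ c → j ≢ 0 → cs j * (0ˢ ^ˢ j) a b c ≡ 0ℚ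
  higher≡0 zero    _ j≢0 = ⊥-elim (j≢0 refl)
  higher≡0 (suc j) _ _   = trans (cong (cs (suc j) *_) (trans (0ˢ⊛F≋0ˢ (0ˢ ^ˢ j) a b c) (0ˢ-coeff a b c))) (*-zeroʳ (cs (suc j)))
    where
    0ˢ⊛F≋0ˢ : ∀ F → 0ˢ ⊛ F ≋ 0ˢ
    0ˢ⊛F≋0ˢ F = solve 1 (λ f → con 0ℚ :* f := con 0ℚ) ≋-refl F
      where
      open ˢ-Solver

-- Linear differential equations in x

VanishesBelow : ℕ → Series → Set
VanishesBelow n W = ∀ a b c → b < n → W a b c ≡ 0ℚ

⊛-vanishesBelow : ∀ {n W} F → VanishesBelow n W → VanishesBelow n (F ⊛ W)
⊛-vanishesBelow {W = W} F W<n a b c b<n = Σ³-zero a b c λ i j k _ j≤b _ →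
  trans (cong (F i j k *_) (W<n (a ∸ i) (b ∸ j) (c ∸ k) (ℕ.≤-<-trans (ℕ.m∸n≤m b j) b<n))) (*-zeroʳ (F i j k))

∂-vanishesBelow : ∀ {n W} → VanishesBelow (suc n) W → VanishesBelow n (∂ W)
∂-vanishesBelow {W = W} W<1+n a b c b<n = trans (cong (ℕtoℚ (suc b) *_) (W<1+n a (suc b) c (s≤s b<n))) (*-zeroʳ (ℕtoℚ (suc b)))

X⊛-vanishesBelow : ∀ {n W} → VanishesBelow n W → VanishesBelow (suc n) (X ⊛ W)
X⊛-vanishesBelow {W = W} W<n a zero    c _           = X⊛≋shiftX W a 0 c
X⊛-vanishesBelow {W = W} W<n a (suc b) c (s≤s b<n) = trans (X⊛≋shiftX W a (suc b) c) (W<n a b c b<n)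

record SolvesODE (K P F : Series) : Set where
  constructor solvesODE
  field equation : (1ˢ ⊖ X ⊛ K) ⊛ ((1ˢ ⊖ X ⊛ K) ⊛ ∂ F) ≋ P ⊛ F

-- Solving for ∂ W shows that the x-degree n coefficients of ∂ W, hence the x-degree n+1
-- coefficients of W, only depend on the coefficients of W of x-degree at most n.
SolvesODE-null : ∀ {K P W} → SolvesODE K P W → VanishesBelow 1 W → W ≋ 0ˢ
SolvesODE-null {K} {P} {W} (solvesODE ode) W<1 a b c = trans (vanish b a b c ℕ.≤-refl) (sym (0ˢ-coeff a b c))
  where
  K′ : Series
  K′ = K ⊕ K ⊖ X ⊛ (K ⊛ K)
  ∂W≋ : ∂ W ≋ P ⊛ W ⊕ X ⊛ (K′ ⊛ ∂ W)
  ∂W≋ = begin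
    ∂ W
      ≈⟨ solve 3 (λ x k w′ → w′ := (con 1ℚ :- x :* k) :* ((con 1ℚ :- x :* k) :* w′) :+ x :* ((k :+ k :- x :* (k :* k)) :* w′))
               ≋-refl X K (∂ W) ⟩
    (1ˢ ⊖ X ⊛ K) ⊛ ((1ˢ ⊖ X ⊛ K) ⊛ ∂ W) ⊕ X ⊛ (K′ ⊛ ∂ W)
      ≈⟨ ⊕-congʳ (X ⊛ (K′ ⊛ ∂ W)) ode ⟩
    P ⊛ W ⊕ X ⊛ (K′ ⊛ ∂ W) ∎
    where
    open ≋-Reasoning
    open ˢ-Solver
  vanish : ∀ n → VanishesBelow (suc n) W
  vanish zero    = W<1
  vanish (suc n) a b c b<2+n with ℕ.m≤n⇒m<n∨m≡n (ℕ.≤-pred b<2+n)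
  ... | inj₁ b<1+n = vanish n a b c b<1+n
  ... | inj₂ refl  = ℕtoℚ[1+n]*p≡0⇒p≡0 n (begin
    ∂ W a n c
      ≡⟨ ∂W≋ a n c ⟩
    (P ⊛ W) a n c + (X ⊛ (K′ ⊛ ∂ W)) a n c
      ≡⟨ cong₂ _+_ (⊛-vanishesBelow P (vanish n) a n c ℕ.≤-refl)
                   (X⊛-vanishesBelow (⊛-vanishesBelow K′ (∂-vanishesBelow (vanish n))) a n c ℕ.≤-refl) ⟩
    0ℚ + 0ℚ
      ≡⟨ +-identityʳ 0ℚ ⟩
    0ℚ ∎)
    where
    open ≡-Reasoning

SolvesODE-unique : ∀ {K P F G} → SolvesODE K P F → SolvesODE K P G → F ≈₀ G → F ≋ G
SolvesODE-unique {K} {P} {F} {G} (solvesODE odeF) (solvesODE odeG) (agree₀ F₀≡G₀) = x∙y⁻¹≈ε⇒x≈y F G (SolvesODE-null {K} {P} odeW W<1)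
  where
  open GroupProperties (CommutativeRing.+-group seriesRing) using (x∙y⁻¹≈ε⇒x≈y)
  odeW : SolvesODE K P (F ⊖ G)
  odeW = solvesODE (begin
    D ⊛ (D ⊛ ∂ (F ⊖ G))         ≈⟨ ⊛-congˡ D (⊛-congˡ D (≋-trans (∂-⊕ F (-ˢ G)) (⊕-congˡ (∂ F) (∂-ˢ G)))) ⟩
    D ⊛ (D ⊛ (∂ F ⊖ ∂ G))       ≈⟨ solve 3 (λ d f′ g′ → d :* (d :* (f′ :- g′)) := d :* (d :* f′) :- d :* (d :* g′)) ≋-refl D (∂ F) (∂ G) ⟩
    D ⊛ (D ⊛ ∂ F) ⊖ D ⊛ (D ⊛ ∂ G) ≈⟨ ⊕-cong odeF (-ˢ-cong odeG) ⟩
    P ⊛ F ⊖ P ⊛ G               ≈⟨ solve 3 (λ p f g → p :* f :- p :* g := p :* (f :- g)) ≋-refl P F G ⟩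
    P ⊛ (F ⊖ G)                 ∎)
    where
    open ≋-Reasoning
    open ˢ-Solver
    D : Series
    D = 1ˢ ⊖ X ⊛ K
  W<1 : VanishesBelow 1 (F ⊖ G)
  W<1 a zero c _ = trans (cong (_- G a 0 c) (F₀≡G₀ a c)) (+-inverseʳ (G a 0 c))
  W<1 a (suc b) c (s≤s ())

SolvesODE-cong : ∀ {K P P′ F F′} → P ≋ P′ → F ≋ F′ → SolvesODE K P F → SolvesODE K P′ F′
SolvesODE-cong {K} {P} {P′} {F} {F′} P≋P′ F≋F′ (solvesODE ode) = solvesODE (begin
  D ⊛ (D ⊛ ∂ F′)  ≈⟨ ⊛-congˡ D (⊛-congˡ D (∂-cong F≋F′)) ⟨
  D ⊛ (D ⊛ ∂ F)   ≈⟨ ode ⟩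
  P ⊛ F           ≈⟨ ⊛-cong P≋P′ F≋F′ ⟩
  P′ ⊛ F′         ∎)
  where
  open ≋-Reasoning
  D : Series
  D = 1ˢ ⊖ X ⊛ K

SolvesODE-⊛expS : ∀ {K S M Q₁ Q₂} → NoConst M →
  (1ˢ ⊖ X ⊛ K) ⊛ ((1ˢ ⊖ X ⊛ K) ⊛ ∂ S) ≋ Q₁ ⊛ S → (1ˢ ⊖ X ⊛ K) ⊛ ((1ˢ ⊖ X ⊛ K) ⊛ ∂ M) ≋ Q₂ →
  SolvesODE K (Q₁ ⊕ Q₂) (S ⊛ expS M)
SolvesODE-⊛expS {K} {S} {M} {Q₁} {Q₂} M₀ D²∂S≋ D²∂M≋ = solvesODE (begin
  D ⊛ (D ⊛ ∂ (S ⊛ E))                         ≈⟨ ⊛-congˡ D (⊛-congˡ D 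
                                                   (≋-trans (∂-⊛ S E) (⊕-congˡ (∂ S ⊛ E) (⊛-congˡ S (∂-expS M₀))))) ⟩
  D ⊛ (D ⊛ (∂ S ⊛ E ⊕ S ⊛ (∂ M ⊛ E)))
    ≈⟨ solve 6 (λ x k s s′ m′ e → d x k :* (d x k :* (s′ :* e :+ s :* (m′ :* e))) := d x k :* (d x k :* s′) :* e :+ d x k :* (d x k :* m′) :* (s :* e))
             ≋-refl X K S (∂ S) (∂ M) E ⟩
  D ⊛ (D ⊛ ∂ S) ⊛ E ⊕ D ⊛ (D ⊛ ∂ M) ⊛ (S ⊛ E) ≈⟨ ⊕-cong (⊛-congʳ E D²∂S≋) (⊛-congʳ (S ⊛ E) D²∂M≋) ⟩
  Q₁ ⊛ S ⊛ E ⊕ Q₂ ⊛ (S ⊛ E)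
    ≈⟨ solve 4 (λ q₁ q₂ s e → q₁ :* s :* e :+ q₂ :* (s :* e) := (q₁ :+ q₂) :* (s :* e)) ≋-refl Q₁ Q₂ S E ⟩
  (Q₁ ⊕ Q₂) ⊛ (S ⊛ E)                          ∎)
  where
  open ≋-Reasoning
  open ˢ-Solver
  d : ∀ {n} → Polynomial n → Polynomial n → Polynomial n
  d x k = con 1ℚ :- x :* k
  D E : Series
  D = 1ˢ ⊖ X ⊛ K
  E = expS M

H : ℕ → ℕ → ℕ → ℕ
H p q k = (p C k) ℕ.* (q C k) ℕ.* k !

Hcoef≡H : ∀ m n k → Hcoef m n k ≡ H m n k
Hcoef≡H m n k with k ≤ᵇ m ⊓ n in k≤ᵇm⊓n
... | true  = refl
... | false with ℕ.⊓-sel m n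
...   | inj₁ m⊓n≡m = sym (cong (λ x → x ℕ.* (n C k) ℕ.* k !) (k>n⇒nCk≡0 (≡.subst (_< k) m⊓n≡m m⊓n<k)))
  where
  m⊓n<k : m ⊓ n < k
  m⊓n<k = ℕ.≰⇒> (λ k≤m⊓n → ≡.subst T k≤ᵇm⊓n (ℕ.≤⇒≤ᵇ k≤m⊓n))
...   | inj₂ m⊓n≡n = sym (trans (cong (λ x → (m C k) ℕ.* x ℕ.* k !) (k>n⇒nCk≡0 (≡.subst (_< k) m⊓n≡n m⊓n<k)))
                              (cong (ℕ._* k !) (ℕ.*-zeroʳ (m C k))))
  where
  m⊓n<k : m ⊓ n < k
  m⊓n<k = ℕ.≰⇒> (λ k≤m⊓n → ≡.subst T k≤ᵇm⊓n (ℕ.≤⇒≤ᵇ k≤m⊓n))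

[1+k]*[1+q]C[1+k]≡[1+q]*qCk : ∀ q k → suc k ℕ.* (suc q C suc k) ≡ suc q ℕ.* (q C k)
[1+k]*[1+q]C[1+k]≡[1+q]*qCk zero    zero    = refl
[1+k]*[1+q]C[1+k]≡[1+q]*qCk zero    (suc k) = begin
  suc (suc k) ℕ.* (1 C suc (suc k)) ≡⟨ cong (suc (suc k) ℕ.*_) (k>n⇒nCk≡0 {1} {suc (suc k)} (s≤s (s≤s z≤n))) ⟩
  suc (suc k) ℕ.* 0                 ≡⟨ ℕ.*-zeroʳ (suc (suc k)) ⟩
  0                               ≡⟨ cong (1 ℕ.*_) (k>n⇒nCk≡0 {0} {suc k} (s≤s z≤n)) ⟨
  1 ℕ.* (0 C suc k)                 ∎
  where
  open ≡-Reasoning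
[1+k]*[1+q]C[1+k]≡[1+q]*qCk (suc q) zero    = trans (ℕ.*-identityˡ (suc (suc q) C 1)) (trans (nC1≡n (suc (suc q))) (sym (ℕ.*-identityʳ (suc (suc q)))))
[1+k]*[1+q]C[1+k]≡[1+q]*qCk (suc q) (suc k) = begin
  suc (suc k) ℕ.* (suc (suc q) C suc (suc k))
    ≡⟨ cong (suc (suc k) ℕ.*_) (nCk+nC[k+1]≡[n+1]C[k+1] (suc q) (suc k)) ⟨
  suc (suc k) ℕ.* (suc q C suc k ℕ.+ suc q C suc (suc k))
    ≡⟨ ℕ.*-distribˡ-+ (suc (suc k)) (suc q C suc k) (suc q C suc (suc k)) ⟩
  suc (suc k) ℕ.* (suc q C suc k) ℕ.+ suc (suc k) ℕ.* (suc q C suc (suc k))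
    ≡⟨ cong₂ ℕ._+_ (cong (suc q C suc k ℕ.+_) ([1+k]*[1+q]C[1+k]≡[1+q]*qCk q k)) ([1+k]*[1+q]C[1+k]≡[1+q]*qCk q (suc k)) ⟩
  (suc q C suc k ℕ.+ suc q ℕ.* (q C k)) ℕ.+ suc q ℕ.* (q C suc k)
    ≡⟨ solve 4 (λ A B C D → (A :+ B :* C) :+ B :* D := A :+ B :* (C :+ D)) refl (suc q C suc k) (suc q) (q C k) (q C suc k) ⟩
  suc q C suc k ℕ.+ suc q ℕ.* (q C k ℕ.+ q C suc k)
    ≡⟨ cong (λ x → suc q C suc k ℕ.+ suc q ℕ.* x) (nCk+nC[k+1]≡[n+1]C[k+1] q k) ⟩
  suc (suc q) ℕ.* (suc q C suc k) ∎
  where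
  open ≡-Reasoning
  open ℕ-Solver

qC[1+k]*[1+k]!≡q*[q-1]Ck*k! : ∀ q k → (q C suc k) ℕ.* (suc k) ! ≡ q ℕ.* (((q ∸ 1) C k) ℕ.* k !)
qC[1+k]*[1+k]!≡q*[q-1]Ck*k! zero    k = refl
qC[1+k]*[1+k]!≡q*[q-1]Ck*k! (suc q) k = begin
  (suc q C suc k) ℕ.* (suc k ℕ.* k !) ≡⟨ solve 3 (λ A B C → A :* (B :* C) := (B :* A) :* C) refl (suc q C suc k) (suc k) (k !) ⟩
  suc k ℕ.* (suc q C suc k) ℕ.* k !   ≡⟨ cong (ℕ._* k !) ([1+k]*[1+q]C[1+k]≡[1+q]*qCk q k) ⟩
  suc q ℕ.* (q C k) ℕ.* k !           ≡⟨ ℕ.*-assoc (suc q) (q C k) (k !) ⟩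
  suc q ℕ.* ((q C k) ℕ.* k !)         ∎
  where
  open ≡-Reasoning
  open ℕ-Solver

-- For q = 0 the junk value q ∸ 1 = 0 is multiplied by q.
H-sucˡ : ∀ p q k → H (suc p) q (suc k) ≡ H p q (suc k) ℕ.+ q ℕ.* H p (q ∸ 1) k
H-sucˡ p q k = begin
  (suc p C suc k) ℕ.* (q C suc k) ℕ.* (suc k) !
    ≡⟨ cong (λ x → x ℕ.* (q C suc k) ℕ.* (suc k) !) (nCk+nC[k+1]≡[n+1]C[k+1] p k) ⟨
  (p C k ℕ.+ p C suc k) ℕ.* (q C suc k) ℕ.* (suc k) !
    ≡⟨ solve 4 (λ A B C F → (A :+ B) :* C :* F := B :* C :* F :+ A :* (C :* F)) refl (p C k) (p C suc k) (q C suc k) ((suc k) !) ⟩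
  H p q (suc k) ℕ.+ (p C k) ℕ.* ((q C suc k) ℕ.* (suc k) !)
    ≡⟨ cong (λ x → H p q (suc k) ℕ.+ (p C k) ℕ.* x) (qC[1+k]*[1+k]!≡q*[q-1]Ck*k! q k) ⟩
  H p q (suc k) ℕ.+ (p C k) ℕ.* (q ℕ.* (((q ∸ 1) C k) ℕ.* k !))
    ≡⟨ cong (H p q (suc k) ℕ.+_) (solve 4 (λ A Q B F → A :* (Q :* (B :* F)) := Q :* (A :* B :* F)) refl (p C k) q ((q ∸ 1) C k) (k !)) ⟩
  H p q (suc k) ℕ.+ q ℕ.* H p (q ∸ 1) k ∎
  where
  open ≡-Reasoning
  open ℕ-Solver

H-comm : ∀ p q k → H p q k ≡ H q p k
H-comm p q k = cong (ℕ._* k !) (ℕ.*-comm (p C k) (q C k))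

H-sucʳ : ∀ p q k → H p (suc q) (suc k) ≡ H p q (suc k) ℕ.+ p ℕ.* H (p ∸ 1) q k
H-sucʳ p q k = begin
  H p (suc q) (suc k)              ≡⟨ H-comm p (suc q) (suc k) ⟩
  H (suc q) p (suc k)              ≡⟨ H-sucˡ q p k ⟩
  H q p (suc k) ℕ.+ p ℕ.* H q (p ∸ 1) k ≡⟨ cong₂ ℕ._+_ (H-comm q p (suc k)) (cong (p ℕ.*_) (H-comm q (p ∸ 1) k)) ⟩
  H p q (suc k) ℕ.+ p ℕ.* H (p ∸ 1) q k ∎
  where
  open ≡-Reasoning

ev od : ℕ → ℕ
ev m = 2 ℕ.* m
od m = suc (2 ℕ.* m)

ev[n]*g[ev[n]∸1] : ∀ n (g : ℕ → ℕ) → ev n ℕ.* g (ev n ∸ 1) ≡ 2 ℕ.* (n ℕ.* g (od (n ∸ 1)))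
ev[n]*g[ev[n]∸1] zero    g = refl
ev[n]*g[ev[n]∸1] (suc n) g = begin
  ev (suc n) ℕ.* g (ev (suc n) ∸ 1)   ≡⟨ cong (λ k → ev (suc n) ℕ.* g (k ∸ 1)) (ℕ.*-suc 2 n) ⟩
  ev (suc n) ℕ.* g (od n)             ≡⟨ ℕ.*-assoc 2 (suc n) (g (od n)) ⟩
  2 ℕ.* (suc n ℕ.* g (od n))          ∎
  where
  open ≡-Reasoning

od[m]*g[ev[m]] : ∀ m (g : ℕ → ℕ) → od m ℕ.* g (ev m) ≡ 2 ℕ.* (m ℕ.* g (ev (suc (m ∸ 1)))) ℕ.+ g (ev m)
od[m]*g[ev[m]] zero    g = ℕ.+-identityʳ (g 0)
od[m]*g[ev[m]] (suc m) g = solve 2 (λ m x → (con 1 :+ con 2 :* m) :* x := con 2 :* (m :* x) :+ x) refl (suc m) (g (ev (suc m)))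
  where
  open ℕ-Solver

-- Exponential generating functions of the H_{p,q}

Coeffs : Set
Coeffs = ℕ → ℕ → ℕ → ℕ

egf : Coeffs → Series
egf f a b c = ℕtoℚ (f a b c) * inv! b * inv! c

U*ᶜ_ X*ᶜ_ Y*ᶜ_ ∂ᶜ_ : Coeffs → Coeffs
(U*ᶜ f) zero    b c = 0
(U*ᶜ f) (suc a) b c = f a b c
(X*ᶜ f) a b c = b ℕ.* f a (b ∸ 1) c
(Y*ᶜ f) a b c = c ℕ.* f a b (c ∸ 1)
(∂ᶜ f) a b c = f a (suc b) c

egf-cong : ∀ {f g} → (∀ a b c → f a b c ≡ g a b c) → egf f ≋ egf g
egf-cong f≗g a b c = cong (λ n → ℕtoℚ n * inv! b * inv! c) (f≗g a b c)

egf-+ : ∀ f g → egf f ⊕ egf g ≋ egf (λ a b c → f a b c ℕ.+ g a b c)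
egf-+ f g a b c = begin
  ℕtoℚ (f a b c) * inv! b * inv! c + ℕtoℚ (g a b c) * inv! b * inv! c
    ≡⟨ solve 4 (λ m n x y → m :* x :* y :+ n :* x :* y := (m :+ n) :* x :* y) refl (ℕtoℚ (f a b c)) (ℕtoℚ (g a b c)) (inv! b) (inv! c) ⟩
  (ℕtoℚ (f a b c) + ℕtoℚ (g a b c)) * inv! b * inv! c
    ≡⟨ cong (λ q → q * inv! b * inv! c) (ℕtoℚ-+ (f a b c) (g a b c)) ⟨
  egf (λ a b c → f a b c ℕ.+ g a b c) a b c ∎
  where
  open ℚ-Solver
  open ≡-Reasoning

egf-* : ∀ n f → const (ℕtoℚ n) ⊛ egf f ≋ egf (λ a b c → n ℕ.* f a b c)
egf-* n f a b c = begin
  (const (ℕtoℚ n) ⊛ egf f) a b c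
    ≡⟨ ·≋const⊛ (ℕtoℚ n) (egf f) a b c ⟨
  ℕtoℚ n * (ℕtoℚ (f a b c) * inv! b * inv! c)
    ≡⟨ solve 4 (λ m k x y → m :* (k :* x :* y) := m :* k :* x :* y) refl (ℕtoℚ n) (ℕtoℚ (f a b c)) (inv! b) (inv! c) ⟩
  ℕtoℚ n * ℕtoℚ (f a b c) * inv! b * inv! c
    ≡⟨ cong (λ q → q * inv! b * inv! c) (ℕtoℚ-* n (f a b c)) ⟨
  egf (λ a b c → n ℕ.* f a b c) a b c ∎
  where
  open ℚ-Solver
  open ≡-Reasoning

egf-∂ : ∀ f → ∂ (egf f) ≋ egf (∂ᶜ f)
egf-∂ f a b c = begin
  ℕtoℚ (suc b) * (ℕtoℚ (f a (suc b) c) * inv! (suc b) * inv! c)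
    ≡⟨ solve 4 (λ m k x y → m :* (k :* x :* y) := k :* (m :* x) :* y) refl (ℕtoℚ (suc b)) (ℕtoℚ (f a (suc b) c)) (inv! (suc b)) (inv! c) ⟩
  ℕtoℚ (f a (suc b) c) * (ℕtoℚ (suc b) * inv! (suc b)) * inv! c
    ≡⟨ cong (λ q → ℕtoℚ (f a (suc b) c) * q * inv! c) (ℕtoℚ[1+n]*inv![1+n]≡inv!n b) ⟩
  ℕtoℚ (f a (suc b) c) * inv! b * inv! c ∎
  where
  open ℚ-Solver
  open ≡-Reasoning

egf-U⊛ : ∀ f → U ⊛ egf f ≋ egf (U*ᶜ f)
egf-U⊛ f a b c = trans (U⊛≋shiftU (egf f) a b c) (shifted a)
  where
  shifted : ∀ a → shiftU (egf f) a b c ≡ egf (U*ᶜ f) a b c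
  shifted zero    = sym (trans (cong (_* inv! c) (*-zeroˡ (inv! b))) (*-zeroˡ (inv! c)))
  shifted (suc a) = refl

egf-X⊛ : ∀ f → X ⊛ egf f ≋ egf (X*ᶜ f)
egf-X⊛ f a b c = trans (X⊛≋shiftX (egf f) a b c) (shifted b)
  where
  shifted : ∀ b → shiftX (egf f) a b c ≡ egf (X*ᶜ f) a b c
  shifted zero    = sym (trans (cong (_* inv! c) (*-zeroˡ (inv! 0))) (*-zeroˡ (inv! c)))
  shifted (suc b) = sym (begin
    ℕtoℚ (suc b ℕ.* f a b c) * inv! (suc b) * inv! c
      ≡⟨ cong (λ q → q * inv! (suc b) * inv! c) (ℕtoℚ-* (suc b) (f a b c)) ⟩
    ℕtoℚ (suc b) * ℕtoℚ (f a b c) * inv! (suc b) * inv! c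
      ≡⟨ solve 4 (λ m k x y → m :* k :* x :* y := k :* (m :* x) :* y) refl (ℕtoℚ (suc b)) (ℕtoℚ (f a b c)) (inv! (suc b)) (inv! c) ⟩
    ℕtoℚ (f a b c) * (ℕtoℚ (suc b) * inv! (suc b)) * inv! c
      ≡⟨ cong (λ q → ℕtoℚ (f a b c) * q * inv! c) (ℕtoℚ[1+n]*inv![1+n]≡inv!n b) ⟩
    ℕtoℚ (f a b c) * inv! b * inv! c ∎)
    where
    open ℚ-Solver
    open ≡-Reasoning

egf-Y⊛ : ∀ f → Y ⊛ egf f ≋ egf (Y*ᶜ f)
egf-Y⊛ f a b c = trans (Y⊛≋shiftY (egf f) a b c) (shifted c)
  where
  shifted : ∀ c → shiftY (egf f) a b c ≡ egf (Y*ᶜ f) a b c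
  shifted zero    = sym (trans (cong (_* inv! 0) (*-zeroˡ (inv! b))) (*-zeroˡ (inv! 0)))
  shifted (suc c) = sym (begin
    ℕtoℚ (suc c ℕ.* f a b c) * inv! b * inv! (suc c)
      ≡⟨ cong (λ q → q * inv! b * inv! (suc c)) (ℕtoℚ-* (suc c) (f a b c)) ⟩
    ℕtoℚ (suc c) * ℕtoℚ (f a b c) * inv! b * inv! (suc c)
      ≡⟨ solve 4 (λ m k x y → m :* k :* x :* y := k :* x :* (m :* y)) refl (ℕtoℚ (suc c)) (ℕtoℚ (f a b c)) (inv! b) (inv! (suc c)) ⟩
    ℕtoℚ (f a b c) * inv! b * (ℕtoℚ (suc c) * inv! (suc c))
      ≡⟨ cong (λ q → ℕtoℚ (f a b c) * inv! b * q) (ℕtoℚ[1+n]*inv![1+n]≡inv!n c) ⟩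
    ℕtoℚ (f a b c) * inv! b * inv! c ∎)
    where
    open ℚ-Solver
    open ≡-Reasoning

egf-U⊛-rec : ∀ f g h → (∀ a b c → f a b c ≡ g a b c ℕ.+ (U*ᶜ h) a b c) → egf f ≋ egf g ⊕ U ⊛ egf h
egf-U⊛-rec f g h f≡g+Uh = begin
  egf f                          ≈⟨ egf-cong f≡g+Uh ⟩
  egf (λ a b c → g a b c ℕ.+ (U*ᶜ h) a b c) ≈⟨ egf-+ g (U*ᶜ h) ⟨
  egf g ⊕ egf (U*ᶜ h)            ≈⟨ ⊕-congˡ (egf g) (egf-U⊛ h) ⟨
  egf g ⊕ U ⊛ egf h              ∎
  where
  open ≋-Reasoning

Hegf : (ℕ → ℕ) → (ℕ → ℕ) → Series
Hegf σ τ = egf (λ a m n → H (σ m) (τ n) a)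

∂-Hegf-ev : ∀ τ → ∂ (Hegf ev τ) ≋ Hegf (λ m → suc (od m)) τ
∂-Hegf-ev τ = ≋-trans (egf-∂ (λ a m n → H (ev m) (τ n) a)) (egf-cong λ a m n → cong (λ p → H p (τ n) a) (ℕ.*-suc 2 m))

Hegf-sucˡ-id : ∀ σ → Hegf (λ m → suc (σ m)) id ≋ Hegf σ id ⊕ U ⊛ (Y ⊛ Hegf σ id)
Hegf-sucˡ-id σ = ≋-trans (egf-U⊛-rec _ (λ a m n → H (σ m) n a) (Y*ᶜ λ a m n → H (σ m) n a) rec) (⊕-congˡ (Hegf σ id) (⊛-congˡ U (≋-sym (egf-Y⊛ (λ a m n → H (σ m) n a)))))
  where
  rec : ∀ a m n → H (suc (σ m)) n a ≡ H (σ m) n a ℕ.+ (U*ᶜ (Y*ᶜ λ a m n → H (σ m) n a)) a m n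
  rec zero    m n = refl
  rec (suc a) m n = H-sucˡ (σ m) n a

Hegf-sucˡ-ev : ∀ σ → Hegf (λ m → suc (σ m)) ev ≋ Hegf σ ev ⊕ const two ⊛ (U ⊛ (Y ⊛ Hegf σ od))
Hegf-sucˡ-ev σ = begin
  Hegf (λ m → suc (σ m)) ev               ≈⟨ egf-U⊛-rec _ (λ a m n → H (σ m) (ev n) a) (λ a m n → 2 ℕ.* (Y*ᶜ f) a m n) rec ⟩
  Hegf σ ev ⊕ U ⊛ egf (λ a m n → 2 ℕ.* (Y*ᶜ f) a m n)
    ≈⟨ ⊕-congˡ (Hegf σ ev) (⊛-congˡ U (≋-trans (⊛-congˡ (const two) (egf-Y⊛ f)) (egf-* 2 (Y*ᶜ f)))) ⟨
  Hegf σ ev ⊕ U ⊛ (const two ⊛ (Y ⊛ Hegf σ od))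
    ≈⟨ solve 4 (λ e u y o → e :+ u :* (con two :* (y :* o)) := e :+ con two :* (u :* (y :* o))) ≋-refl (Hegf σ ev) U Y (Hegf σ od) ⟩
  Hegf σ ev ⊕ const two ⊛ (U ⊛ (Y ⊛ Hegf σ od)) ∎
  where
  open ≋-Reasoning
  open ˢ-Solver
  f : Coeffs
  f a m n = H (σ m) (od n) a
  rec : ∀ a m n → H (suc (σ m)) (ev n) a ≡ H (σ m) (ev n) a ℕ.+ (U*ᶜ (λ a m n → 2 ℕ.* (Y*ᶜ f) a m n)) a m n
  rec zero    m n = refl
  rec (suc a) m n = trans (H-sucˡ (σ m) (ev n) a) (cong (H (σ m) (ev n) (suc a) ℕ.+_) (ev[n]*g[ev[n]∸1] n (λ q → H (σ m) q a)))

Hegf-sucʳ-ev : ∀ τ → Hegf ev (λ n → suc (τ n)) ≋ Hegf ev τ ⊕ const two ⊛ (U ⊛ (X ⊛ Hegf od τ))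
Hegf-sucʳ-ev τ = begin
  Hegf ev (λ n → suc (τ n))               ≈⟨ egf-U⊛-rec _ (λ a m n → H (ev m) (τ n) a) (λ a m n → 2 ℕ.* (X*ᶜ f) a m n) rec ⟩
  Hegf ev τ ⊕ U ⊛ egf (λ a m n → 2 ℕ.* (X*ᶜ f) a m n)
    ≈⟨ ⊕-congˡ (Hegf ev τ) (⊛-congˡ U (≋-trans (⊛-congˡ (const two) (egf-X⊛ f)) (egf-* 2 (X*ᶜ f)))) ⟨
  Hegf ev τ ⊕ U ⊛ (const two ⊛ (X ⊛ Hegf od τ))
    ≈⟨ solve 4 (λ e u x o → e :+ u :* (con two :* (x :* o)) := e :+ con two :* (u :* (x :* o))) ≋-refl (Hegf ev τ) U X (Hegf od τ) ⟩
  Hegf ev τ ⊕ const two ⊛ (U ⊛ (X ⊛ Hegf od τ)) ∎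
  where
  open ≋-Reasoning
  open ˢ-Solver
  f : Coeffs
  f a m n = H (od m) (τ n) a
  rec : ∀ a m n → H (ev m) (suc (τ n)) a ≡ H (ev m) (τ n) a ℕ.+ (U*ᶜ (λ a m n → 2 ℕ.* (X*ᶜ f) a m n)) a m n
  rec zero    m n = refl
  rec (suc a) m n = trans (H-sucʳ (ev m) (τ n) a) (cong (H (ev m) (τ n) (suc a) ℕ.+_) (ev[n]*g[ev[n]∸1] m (λ p → H p (τ n) a)))

Hegf-sucʳ-od : ∀ τ → Hegf od (λ n → suc (τ n)) ≋ Hegf od τ ⊕ U ⊛ (const two ⊛ (X ⊛ ∂ (Hegf ev τ)) ⊕ Hegf ev τ)
Hegf-sucʳ-od τ = begin
  Hegf od (λ n → suc (τ n))               ≈⟨ egf-U⊛-rec _ (λ a m n → H (od m) (τ n) a) (λ a m n → 2 ℕ.* (X*ᶜ ∂ᶜ f) a m n ℕ.+ f a m n) rec ⟩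
  Hegf od τ ⊕ U ⊛ egf (λ a m n → 2 ℕ.* (X*ᶜ ∂ᶜ f) a m n ℕ.+ f a m n)
    ≈⟨ ⊕-congˡ (Hegf od τ) (⊛-congˡ U (begin
         const two ⊛ (X ⊛ ∂ (egf f)) ⊕ egf f
           ≈⟨ ⊕-congʳ (egf f) (⊛-congˡ (const two) (≋-trans (⊛-congˡ X (egf-∂ f)) (egf-X⊛ (∂ᶜ f)))) ⟩
         const two ⊛ egf (X*ᶜ ∂ᶜ f) ⊕ egf f
           ≈⟨ ⊕-congʳ (egf f) (egf-* 2 (X*ᶜ ∂ᶜ f)) ⟩
         egf (λ a m n → 2 ℕ.* (X*ᶜ ∂ᶜ f) a m n) ⊕ egf f
           ≈⟨ egf-+ (λ a m n → 2 ℕ.* (X*ᶜ ∂ᶜ f) a m n) f ⟩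
         egf (λ a m n → 2 ℕ.* (X*ᶜ ∂ᶜ f) a m n ℕ.+ f a m n) ∎)) ⟨
  Hegf od τ ⊕ U ⊛ (const two ⊛ (X ⊛ ∂ (Hegf ev τ)) ⊕ Hegf ev τ) ∎
  where
  open ≋-Reasoning
  f : Coeffs
  f a m n = H (ev m) (τ n) a
  rec : ∀ a m n → H (od m) (suc (τ n)) a ≡ H (od m) (τ n) a ℕ.+ (U*ᶜ (λ a m n → 2 ℕ.* (X*ᶜ ∂ᶜ f) a m n ℕ.+ f a m n)) a m n
  rec zero    m n = refl
  rec (suc a) m n = trans (H-sucʳ (od m) (τ n) a) (cong (H (od m) (τ n) (suc a) ℕ.+_) (od[m]*g[ev[m]] m (λ p → H p (τ n) a)))

Hdiag Hdiag⁺ : Coeffs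
Hdiag  a m zero    = H m m a
Hdiag  a m (suc _) = 0
Hdiag⁺ a m zero    = H m (suc m) a
Hdiag⁺ a m (suc _) = 0

Hdiag⁺-rec : egf Hdiag⁺ ≋ egf Hdiag ⊕ U ⊛ (X ⊛ egf Hdiag⁺)
Hdiag⁺-rec = ≋-trans (egf-U⊛-rec Hdiag⁺ Hdiag (X*ᶜ Hdiag⁺) rec) (⊕-congˡ (egf Hdiag) (⊛-congˡ U (≋-sym (egf-X⊛ Hdiag⁺))))
  where
  rec : ∀ a m c → Hdiag⁺ a m c ≡ Hdiag a m c ℕ.+ (U*ᶜ X*ᶜ Hdiag⁺) a m c
  rec zero    m       zero    = refl
  rec (suc a) zero    zero    = refl
  rec (suc a) (suc m) zero    = H-sucʳ (suc m) (suc m) a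
  rec zero    m       (suc c) = refl
  rec (suc a) m       (suc c) = sym (ℕ.*-zeroʳ m)

∂-Hdiag-rec : ∂ (egf Hdiag) ≋ egf Hdiag⁺ ⊕ U ⊛ (X ⊛ ∂ (egf Hdiag) ⊕ egf Hdiag)
∂-Hdiag-rec = begin
  ∂ (egf Hdiag)                                   ≈⟨ egf-∂ Hdiag ⟩
  egf (∂ᶜ Hdiag)                                  ≈⟨ egf-U⊛-rec (∂ᶜ Hdiag) Hdiag⁺ (λ a m c → (X*ᶜ ∂ᶜ Hdiag) a m c ℕ.+ Hdiag a m c) rec ⟩
  egf Hdiag⁺ ⊕ U ⊛ egf (λ a m c → (X*ᶜ ∂ᶜ Hdiag) a m c ℕ.+ Hdiag a m c)
    ≈⟨ ⊕-congˡ (egf Hdiag⁺) (⊛-congˡ U (begin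
         X ⊛ ∂ (egf Hdiag) ⊕ egf Hdiag       ≈⟨ ⊕-congʳ (egf Hdiag) (≋-trans (⊛-congˡ X (egf-∂ Hdiag)) (egf-X⊛ (∂ᶜ Hdiag))) ⟩
         egf (X*ᶜ ∂ᶜ Hdiag) ⊕ egf Hdiag      ≈⟨ egf-+ (X*ᶜ ∂ᶜ Hdiag) Hdiag ⟩
         egf (λ a m c → (X*ᶜ ∂ᶜ Hdiag) a m c ℕ.+ Hdiag a m c) ∎)) ⟨
  egf Hdiag⁺ ⊕ U ⊛ (X ⊛ ∂ (egf Hdiag) ⊕ egf Hdiag) ∎
  where
  open ≋-Reasoning
  rec : ∀ a m c → Hdiag a (suc m) c ≡ Hdiag⁺ a m c ℕ.+ (U*ᶜ λ a m c → (X*ᶜ ∂ᶜ Hdiag) a m c ℕ.+ Hdiag a m c) a m c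
  rec zero    m       zero    = refl
  rec (suc a) zero    zero    = trans (H-sucˡ 0 1 a) (cong (H 0 1 (suc a) ℕ.+_) (ℕ.+-identityʳ (H 0 0 a)))
  rec (suc a) (suc m) zero    = trans (H-sucˡ (suc m) (suc (suc m)) a) (cong (H (suc m) (suc (suc m)) (suc a) ℕ.+_) (ℕ.+-comm (H (suc m) (suc m) a) _))
  rec zero    m       (suc c) = refl
  rec (suc a) m       (suc c) = sym (trans (ℕ.+-identityʳ (m ℕ.* 0)) (ℕ.*-zeroʳ m))

-- The differential equations and the left-hand sides

P₁ K₂ P₂ P₃ : Series
P₁ = (1ˢ ⊕ U ⊛ Y) ⊛ (1ˢ ⊕ U ⊛ Y)
K₂ = const four ⊛ (U ⊛ (U ⊛ Y))
P₂ = (1ˢ ⊕ const two ⊛ (U ⊛ Y)) ⊛ (1ˢ ⊕ const two ⊛ (U ⊛ Y)) ⊕ const two ⊛ (U ⊛ (U ⊛ Y)) ⊛ (1ˢ ⊖ X ⊛ K₂)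
P₃ = 1ˢ ⊕ U ⊖ U ⊛ (U ⊛ X)

Hegf-ev-id-ode : SolvesODE 0ˢ P₁ (Hegf ev id)
Hegf-ev-id-ode = solvesODE (begin
  D ⊛ (D ⊛ ∂ E)
    ≈⟨ solve 2 (λ x e′ → (con 1ℚ :- x :* con 0ℚ) :* ((con 1ℚ :- x :* con 0ℚ) :* e′) := e′) ≋-refl X (∂ E) ⟩
  ∂ E                                      ≈⟨ ≋-trans (∂-Hegf-ev id) (Hegf-sucˡ-id od) ⟩
  O ⊕ U ⊛ (Y ⊛ O)                          ≈⟨ ⊕-cong O≋ (⊛-congˡ U (⊛-congˡ Y O≋)) ⟩
  E ⊕ U ⊛ (Y ⊛ E) ⊕ U ⊛ (Y ⊛ (E ⊕ U ⊛ (Y ⊛ E)))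
    ≈⟨ solve 3 (λ u y e → e :+ u :* (y :* e) :+ u :* (y :* (e :+ u :* (y :* e))) := (con 1ℚ :+ u :* y) :* (con 1ℚ :+ u :* y) :* e)
             ≋-refl U Y E ⟩
  P₁ ⊛ E                                   ∎)
  where
  open ≋-Reasoning
  open ˢ-Solver
  D E O : Series
  D = 1ˢ ⊖ X ⊛ 0ˢ
  E = Hegf ev id
  O = Hegf od id
  O≋ : O ≋ E ⊕ U ⊛ (Y ⊛ E)
  O≋ = Hegf-sucˡ-id ev

Hegf-ev-ev-ode : SolvesODE K₂ P₂ (Hegf ev ev)
Hegf-ev-ev-ode = solvesODE (begin
  D ⊛ (D ⊛ ∂ E)                                    ≈⟨ ⊛-congˡ D D⊛∂E≋ ⟩
  D ⊛ (L ⊛ A ⊕ const two ⊛ (U ⊛ (U ⊛ Y)) ⊛ E)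
    ≈⟨ solve 5 (λ u x y a e → d u x y :* (l u y :* a :+ con two :* (u :* (u :* y)) :* e)
                            := l u y :* (d u x y :* a) :+ con two :* (u :* (u :* y)) :* d u x y :* e) ≋-refl U X Y A E ⟩
  L ⊛ (D ⊛ A) ⊕ const two ⊛ (U ⊛ (U ⊛ Y)) ⊛ D ⊛ E ≈⟨ ⊕-congʳ (const two ⊛ (U ⊛ (U ⊛ Y)) ⊛ D ⊛ E) (⊛-congˡ L D⊛A≋L⊛E) ⟩
  L ⊛ (L ⊛ E) ⊕ const two ⊛ (U ⊛ (U ⊛ Y)) ⊛ D ⊛ E
    ≈⟨ solve 4 (λ u x y e → l u y :* (l u y :* e) :+ con two :* (u :* (u :* y)) :* d u x y :* e
                          := (l u y :* l u y :+ con two :* (u :* (u :* y)) :* d u x y) :* e) ≋-refl U X Y E ⟩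
  P₂ ⊛ E                                           ∎)
  where
  open ≋-Reasoning
  open ˢ-Solver
  d : ∀ {n} → Polynomial n → Polynomial n → Polynomial n → Polynomial n
  d u x y = con 1ℚ :- x :* (con four :* (u :* (u :* y)))
  l : ∀ {n} → Polynomial n → Polynomial n → Polynomial n
  l u y = con 1ℚ :+ con two :* (u :* y)
  D L E A B C : Series
  D = 1ˢ ⊖ X ⊛ K₂
  L = 1ˢ ⊕ const two ⊛ (U ⊛ Y)
  E = Hegf ev ev
  A = Hegf od ev
  B = Hegf ev od
  C = Hegf od od
  D⊛A≋L⊛E : D ⊛ A ≋ L ⊛ E
  D⊛A≋L⊛E = fixpoint-elim {K = K₂} (begin
    A                                                            ≈⟨ Hegf-sucˡ-ev ev ⟩
    E ⊕ const two ⊛ (U ⊛ (Y ⊛ B))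
      ≈⟨ ⊕-congˡ E (⊛-congˡ (const two) (⊛-congˡ U (⊛-congˡ Y (Hegf-sucʳ-ev ev)))) ⟩
    E ⊕ const two ⊛ (U ⊛ (Y ⊛ (E ⊕ const two ⊛ (U ⊛ (X ⊛ A)))))
      ≈⟨ solve 5 (λ u x y a e → e :+ con two :* (u :* (y :* (e :+ con two :* (u :* (x :* a)))))
                              := l u y :* e :+ x :* (con four :* (u :* (u :* y)) :* a)) ≋-refl U X Y A E ⟩
    L ⊛ E ⊕ X ⊛ (K₂ ⊛ A)                                         ∎)
  D⊛∂E≋ : D ⊛ ∂ E ≋ L ⊛ A ⊕ const two ⊛ (U ⊛ (U ⊛ Y)) ⊛ E
  D⊛∂E≋ = fixpoint-elim {K = K₂} (begin
    ∂ E                                                          ≈⟨ ≋-trans (∂-Hegf-ev ev) (Hegf-sucˡ-ev od) ⟩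
    A ⊕ const two ⊛ (U ⊛ (Y ⊛ C))
      ≈⟨ ⊕-congˡ A (⊛-congˡ (const two) (⊛-congˡ U (⊛-congˡ Y (Hegf-sucʳ-od ev)))) ⟩
    A ⊕ const two ⊛ (U ⊛ (Y ⊛ (A ⊕ U ⊛ (const two ⊛ (X ⊛ ∂ E) ⊕ E))))
      ≈⟨ solve 6 (λ u x y a e e′ → a :+ con two :* (u :* (y :* (a :+ u :* (con two :* (x :* e′) :+ e))))
                                 := l u y :* a :+ con two :* (u :* (u :* y)) :* e :+ x :* (con four :* (u :* (u :* y)) :* e′)) ≋-refl U X Y A E (∂ E) ⟩
    L ⊛ A ⊕ const two ⊛ (U ⊛ (U ⊛ Y)) ⊛ E ⊕ X ⊛ (K₂ ⊛ ∂ E)       ∎)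

Hdiag-ode : SolvesODE U P₃ (egf Hdiag)
Hdiag-ode = solvesODE (begin
  D ⊛ (D ⊛ ∂ F)        ≈⟨ ⊛-congˡ D D⊛∂F≋G⊕U⊛F ⟩
  D ⊛ (G ⊕ U ⊛ F)
    ≈⟨ solve 4 (λ u x g f → (con 1ℚ :- x :* u) :* (g :+ u :* f) := (con 1ℚ :- x :* u) :* g :+ u :* ((con 1ℚ :- x :* u) :* f)) ≋-refl U X G F ⟩
  D ⊛ G ⊕ U ⊛ (D ⊛ F)  ≈⟨ ⊕-congʳ (U ⊛ (D ⊛ F)) D⊛G≋F ⟩
  F ⊕ U ⊛ (D ⊛ F)      ≈⟨ solve 3 (λ u x f → f :+ u :* ((con 1ℚ :- x :* u) :* f) := (con 1ℚ :+ u :- u :* (u :* x)) :* f) ≋-refl U X F ⟩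
  P₃ ⊛ F               ∎)
  where
  open ≋-Reasoning
  open ˢ-Solver
  D F G : Series
  D = 1ˢ ⊖ X ⊛ U
  F = egf Hdiag
  G = egf Hdiag⁺
  D⊛G≋F : D ⊛ G ≋ F
  D⊛G≋F = fixpoint-elim {K = U} (≋-trans Hdiag⁺-rec (solve 4 (λ u x g f → f :+ u :* (x :* g) := f :+ x :* (u :* g)) ≋-refl U X G F))
  D⊛∂F≋G⊕U⊛F : D ⊛ ∂ F ≋ G ⊕ U ⊛ F
  D⊛∂F≋G⊕U⊛F = fixpoint-elim {K = U} (≋-trans ∂-Hdiag-rec
    (solve 5 (λ u x g f f′ → g :+ u :* (x :* f′ :+ f) := g :+ u :* f :+ x :* (u :* f′)) ≋-refl U X G F (∂ F)))

-- The right-hand sides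

XFree-P₁ : XFree P₁
XFree-P₁ = XFree-⊛ 1+UY 1+UY
  where
  1+UY : XFree (1ˢ ⊕ U ⊛ Y)
  1+UY = XFree-⊕ (XFree-const 1ℚ) (XFree-⊛ XFree-U XFree-Y)

∂-X⊛⊕Y : ∀ {P} → XFree P → ∂ (X ⊛ P ⊕ Y) ≋ P
∂-X⊛⊕Y {P} P-xfree = begin
  ∂ (X ⊛ P ⊕ Y)       ≈⟨ ≋-trans (∂-⊕ (X ⊛ P) Y) (⊕-cong (∂-X⊛ P-xfree) ∂Y≋0ˢ) ⟩
  P ⊕ 0ˢ              ≈⟨ solve 1 (λ p → p :+ con 0ℚ := p) ≋-refl P ⟩
  P                   ∎
  where
  open ≋-Reasoning
  open ˢ-Solver

RHS1≋ : RHS1 ≋ expS (X ⊛ P₁ ⊕ Y)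
RHS1≋ = expS-cong (begin
  X ⊕ Y ⊕ two · (U ⊛ X ⊛ Y) ⊕ U ⊛ U ⊛ X ⊛ Y ⊛ Y
    ≈⟨ ⊕-congʳ (U ⊛ U ⊛ X ⊛ Y ⊛ Y) (⊕-congˡ (X ⊕ Y) (·≋const⊛ two (U ⊛ X ⊛ Y))) ⟩
  X ⊕ Y ⊕ const two ⊛ (U ⊛ X ⊛ Y) ⊕ U ⊛ U ⊛ X ⊛ Y ⊛ Y
    ≈⟨ solve 3 (λ u x y → x :+ y :+ con two :* (u :* x :* y) :+ u :* u :* x :* y :* y := x :* ((con 1ℚ :+ u :* y) :* (con 1ℚ :+ u :* y)) :+ y)
             ≋-refl U X Y ⟩
  X ⊛ P₁ ⊕ Y ∎)
  where
  open ≋-Reasoning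
  open ˢ-Solver

expS[X⊛P₁⊕Y]-ode : SolvesODE 0ˢ P₁ (expS (X ⊛ P₁ ⊕ Y))
expS[X⊛P₁⊕Y]-ode = solvesODE (begin
  D ⊛ (D ⊛ ∂ (expS M))   ≈⟨ solve 2 (λ x e′ → (con 1ℚ :- x :* con 0ℚ) :* ((con 1ℚ :- x :* con 0ℚ) :* e′) := e′) ≋-refl X (∂ (expS M)) ⟩
  ∂ (expS M)             ≈⟨ ∂-expS (NoConst-⊕ (NoConst-X⊛ P₁) NoConst-Y) ⟩
  ∂ M ⊛ expS M           ≈⟨ ⊛-congʳ (expS M) (∂-X⊛⊕Y XFree-P₁) ⟩
  P₁ ⊛ expS M            ∎)
  where
  open ≋-Reasoning
  open ˢ-Solver
  D M : Series
  D = 1ˢ ⊖ X ⊛ 0ˢ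
  M = X ⊛ P₁ ⊕ Y

α₂ : ℚ
α₂ = - ((+ 1) / 2)

N₂ A₂ S₂ : Series
N₂ = 1ˢ ⊕ const four ⊛ (U ⊛ Y)
A₂ = inv1m (X ⊛ K₂)
S₂ = pow1p α₂ (-ˢ (X ⊛ K₂))

XFree-K₂ : XFree K₂
XFree-K₂ = XFree-⊛ (XFree-const four) (XFree-⊛ XFree-U (XFree-⊛ XFree-U XFree-Y))

XFree-N₂ : XFree N₂
XFree-N₂ = XFree-⊕ (XFree-const 1ℚ) (XFree-⊛ (XFree-const four) (XFree-⊛ XFree-U XFree-Y))

RHS2≋ : RHS2 ≋ S₂ ⊛ expS ((X ⊛ N₂ ⊕ Y) ⊛ A₂)
RHS2≋ = ⊛-cong (pow1p-cong α₂ H≋) (expS-cong (⊛-cong L≋ (inv1m-cong G≋)))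
  where
  open ≋-Reasoning
  open ˢ-Solver
  H≋ : 0ˢ ⊖ four · (U ⊛ U ⊛ X ⊛ Y) ≋ -ˢ (X ⊛ K₂)
  H≋ = begin
    0ˢ ⊖ four · (U ⊛ U ⊛ X ⊛ Y)         ≈⟨ ⊕-congˡ 0ˢ (-ˢ-cong (·≋const⊛ four (U ⊛ U ⊛ X ⊛ Y))) ⟩
    0ˢ ⊖ const four ⊛ (U ⊛ U ⊛ X ⊛ Y)
      ≈⟨ solve 3 (λ u x y → con 0ℚ :- con four :* (u :* u :* x :* y) := :- (x :* (con four :* (u :* (u :* y))))) ≋-refl U X Y ⟩
    -ˢ (X ⊛ K₂)                        ∎
  L≋ : X ⊕ Y ⊕ four · (U ⊛ X ⊛ Y) ≋ X ⊛ N₂ ⊕ Y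
  L≋ = begin
    X ⊕ Y ⊕ four · (U ⊛ X ⊛ Y)          ≈⟨ ⊕-congˡ (X ⊕ Y) (·≋const⊛ four (U ⊛ X ⊛ Y)) ⟩
    X ⊕ Y ⊕ const four ⊛ (U ⊛ X ⊛ Y)
      ≈⟨ solve 3 (λ u x y → x :+ y :+ con four :* (u :* x :* y) := x :* (con 1ℚ :+ con four :* (u :* y)) :+ y) ≋-refl U X Y ⟩
    X ⊛ N₂ ⊕ Y                         ∎
  G≋ : four · (U ⊛ U ⊛ X ⊛ Y) ≋ X ⊛ K₂
  G≋ = begin
    four · (U ⊛ U ⊛ X ⊛ Y)              ≈⟨ ·≋const⊛ four (U ⊛ U ⊛ X ⊛ Y) ⟩
    const four ⊛ (U ⊛ U ⊛ X ⊛ Y)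
      ≈⟨ solve 3 (λ u x y → con four :* (u :* u :* x :* y) := x :* (con four :* (u :* (u :* y)))) ≋-refl U X Y ⟩
    X ⊛ K₂                             ∎

S₂⊛expS-ode : SolvesODE K₂ P₂ (S₂ ⊛ expS ((X ⊛ N₂ ⊕ Y) ⊛ A₂))
S₂⊛expS-ode = SolvesODE-cong Q₁⊕Q₂≋P₂ ≋-refl
  (SolvesODE-⊛expS {K = K₂} {S₂} {(X ⊛ N₂ ⊕ Y) ⊛ A₂} {const α₂ ⊛ -ˢ K₂ ⊛ D} {∂ (X ⊛ N₂ ⊕ Y) ⊛ D ⊕ (X ⊛ N₂ ⊕ Y) ⊛ K₂}
                    (NoConst-⊛ A₂ (NoConst-⊕ (NoConst-X⊛ N₂) NoConst-Y)) D²∂S₂≋ (D²∂[N⊛inv1m] XFree-K₂ (X ⊛ N₂ ⊕ Y)))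
  where
  open ≋-Reasoning
  open ˢ-Solver
  D : Series
  D = 1ˢ ⊖ X ⊛ K₂
  D²∂S₂≋ : D ⊛ (D ⊛ ∂ S₂) ≋ (const α₂ ⊛ -ˢ K₂ ⊛ D) ⊛ S₂
  D²∂S₂≋ = begin
    D ⊛ (D ⊛ ∂ S₂)                        ≈⟨ ⊛-congˡ D (∂-pow1p (NoConst-ˢ (NoConst-X⊛ K₂)) α₂) ⟩
    D ⊛ (const α₂ ⊛ (∂ (-ˢ (X ⊛ K₂)) ⊛ S₂))
      ≈⟨ ⊛-congˡ D (⊛-congˡ (const α₂) (⊛-congʳ S₂ (≋-trans (∂-ˢ (X ⊛ K₂)) (-ˢ-cong (∂-X⊛ XFree-K₂))))) ⟩
    D ⊛ (const α₂ ⊛ (-ˢ K₂ ⊛ S₂))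
      ≈⟨ solve 4 (λ x k a s → (con 1ℚ :- x :* k) :* (a :* (:- k :* s)) := (a :* (:- k) :* (con 1ℚ :- x :* k)) :* s) ≋-refl X K₂ (const α₂) S₂ ⟩
    (const α₂ ⊛ -ˢ K₂ ⊛ D) ⊛ S₂          ∎
  Q₁⊕Q₂≋P₂ : const α₂ ⊛ -ˢ K₂ ⊛ D ⊕ (∂ (X ⊛ N₂ ⊕ Y) ⊛ D ⊕ (X ⊛ N₂ ⊕ Y) ⊛ K₂) ≋ P₂
  Q₁⊕Q₂≋P₂ = begin
    const α₂ ⊛ -ˢ K₂ ⊛ D ⊕ (∂ (X ⊛ N₂ ⊕ Y) ⊛ D ⊕ (X ⊛ N₂ ⊕ Y) ⊛ K₂)
      ≈⟨ ⊕-congˡ (const α₂ ⊛ -ˢ K₂ ⊛ D) (⊕-congʳ ((X ⊛ N₂ ⊕ Y) ⊛ K₂) (⊛-congʳ D (∂-X⊛⊕Y XFree-N₂))) ⟩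
    const α₂ ⊛ -ˢ K₂ ⊛ D ⊕ (N₂ ⊛ D ⊕ (X ⊛ N₂ ⊕ Y) ⊛ K₂)
      ≈⟨ solve 3 (λ u x y → con α₂ :* (:- k u y) :* d u x y :+ (l u y :* d u x y :+ (x :* l u y :+ y) :* k u y)
                          := (con 1ℚ :+ con two :* (u :* y)) :* (con 1ℚ :+ con two :* (u :* y)) :+ con two :* (u :* (u :* y)) :* d u x y) ≋-refl U X Y ⟩
    P₂ ∎
    where
    k l : ∀ {n} → Polynomial n → Polynomial n → Polynomial n
    k u y = con four :* (u :* (u :* y))
    l u y = con 1ℚ :+ con four :* (u :* y)
    d : ∀ {n} → Polynomial n → Polynomial n → Polynomial n → Polynomial n
    d u x y = con 1ℚ :- x :* k u y

A₃ : Series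
A₃ = inv1m (X ⊛ U)

RHS3≋ : RHS3 ≋ A₃ ⊛ expS (X ⊛ A₃)
RHS3≋ = ⊛-cong inv1m[U⊛X]≋A₃ (expS-cong (⊛-congˡ X inv1m[U⊛X]≋A₃))
  where
  inv1m[U⊛X]≋A₃ : inv1m (U ⊛ X) ≋ A₃
  inv1m[U⊛X]≋A₃ = inv1m-cong (⊛-comm U X)

A₃⊛expS-ode : SolvesODE U P₃ (A₃ ⊛ expS (X ⊛ A₃))
A₃⊛expS-ode = SolvesODE-cong Q₁⊕Q₂≋P₃ ≋-refl
  (SolvesODE-⊛expS {K = U} {A₃} {X ⊛ A₃} {U ⊛ (1ˢ ⊖ X ⊛ U)} {∂ X ⊛ (1ˢ ⊖ X ⊛ U) ⊕ X ⊛ U}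
                    (NoConst-X⊛ A₃) (D²∂inv1m XFree-U) (D²∂[N⊛inv1m] XFree-U X))
  where
  open ≋-Reasoning
  open ˢ-Solver
  Q₁⊕Q₂≋P₃ : U ⊛ (1ˢ ⊖ X ⊛ U) ⊕ (∂ X ⊛ (1ˢ ⊖ X ⊛ U) ⊕ X ⊛ U) ≋ P₃
  Q₁⊕Q₂≋P₃ = begin
    U ⊛ (1ˢ ⊖ X ⊛ U) ⊕ (∂ X ⊛ (1ˢ ⊖ X ⊛ U) ⊕ X ⊛ U)
      ≈⟨ ⊕-congˡ (U ⊛ (1ˢ ⊖ X ⊛ U)) (⊕-congʳ (X ⊛ U) (⊛-congʳ (1ˢ ⊖ X ⊛ U) ∂X≋1ˢ)) ⟩
    U ⊛ (1ˢ ⊖ X ⊛ U) ⊕ (1ˢ ⊛ (1ˢ ⊖ X ⊛ U) ⊕ X ⊛ U)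
      ≈⟨ solve 2 (λ u x → u :* (con 1ℚ :- x :* u) :+ (con 1ℚ :* (con 1ℚ :- x :* u) :+ x :* u) := con 1ℚ :+ u :- u :* (u :* x)) ≋-refl U X ⟩
    P₃ ∎

Y^ˢ-coeff : ∀ j a b c → j ≤ c → (Y ^ˢ j) a b c ≡ 1ˢ a b (c ∸ j)
Y^ˢ-coeff zero    a b c       _         = refl
Y^ˢ-coeff (suc j) a b (suc c) (s≤s j≤c) = trans (Y⊛≋shiftY (Y ^ˢ j) a b (suc c)) (Y^ˢ-coeff j a b c j≤c)

H₀ₙ : ∀ n k → H 0 n k ≡ H 0 0 k
H₀ₙ n zero    = refl
H₀ₙ n (suc k) = refl

expS-Y-coeff₀ : ∀ a c → expS Y a 0 c ≡ ℕtoℚ (H 0 0 a) * inv! 0 * inv! c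
expS-Y-coeff₀ a c = begin
  sumTo c (λ j → inv! j * (Y ^ˢ j) a 0 c)  ≡⟨ Σ-single c c ℕ.≤-refl lower≡0 ⟩
  inv! c * (Y ^ˢ c) a 0 c                  ≡⟨ cong (inv! c *_) (trans (Y^ˢ-coeff c a 0 c ℕ.≤-refl) (cong (1ˢ a 0) (ℕ.n∸n≡0 c))) ⟩
  inv! c * 1ˢ a 0 0                        ≡⟨ constant-term a ⟩
  ℕtoℚ (H 0 0 a) * inv! 0 * inv! c         ∎
  where
  open ≡-Reasoning
  1ˢ[a,0,k]≡0 : ∀ a k → k ≢ 0 → 1ˢ a 0 k ≡ 0ℚ
  1ˢ[a,0,k]≡0 zero    zero    k≢0 = ⊥-elim (k≢0 refl)
  1ˢ[a,0,k]≡0 zero    (suc k) _   = refl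
  1ˢ[a,0,k]≡0 (suc a) k       _   = refl
  lower≡0 : ∀ j → j ≤ c → j ≢ c → inv! j * (Y ^ˢ j) a 0 c ≡ 0ℚ
  lower≡0 j j≤c j≢c = trans (cong (inv! j *_) (trans (Y^ˢ-coeff j a 0 c j≤c)
                              (1ˢ[a,0,k]≡0 a (c ∸ j) (λ c∸j≡0 → j≢c (ℕ.≤-antisym j≤c (ℕ.m∸n≡0⇒m≤n c∸j≡0))))))
                            (*-zeroʳ (inv! j))
  constant-term : ∀ a → inv! c * 1ˢ a 0 0 ≡ ℕtoℚ (H 0 0 a) * inv! 0 * inv! c
  constant-term zero    = trans (*-identityʳ (inv! c)) (sym (*-identityˡ (inv! c)))
  constant-term (suc a) = trans (*-zeroʳ (inv! c)) (sym (*-zeroˡ (inv! c)))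

LHS1≋Hegf : LHS1 ≋ Hegf ev id
LHS1≋Hegf = egf-cong λ a m n → Hcoef≡H (ev m) n a

LHS2≋Hegf : LHS2 ≋ Hegf ev ev
LHS2≋Hegf = egf-cong λ a m n → Hcoef≡H (ev m) (ev n) a

LHS3≋egf : LHS3 ≋ egf Hdiag
LHS3≋egf a m zero    = trans (cong (λ h → ℕtoℚ h * inv! m) (Hcoef≡H m m a)) (sym (*-identityʳ (ℕtoℚ (H m m a) * inv! m)))
LHS3≋egf a m (suc c) = sym (trans (cong (_* inv! (suc c)) (*-zeroˡ (inv! m))) (*-zeroˡ (inv! (suc c))))

LHS1₀ : LHS1 ≈₀ expS Y
LHS1₀ = agree₀ λ a c → trans (cong (λ h → ℕtoℚ h * inv! 0 * inv! c) (trans (Hcoef≡H 0 c a) (H₀ₙ c a))) (sym (expS-Y-coeff₀ a c))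

LHS2₀ : LHS2 ≈₀ expS Y
LHS2₀ = agree₀ λ a c → trans (cong (λ h → ℕtoℚ h * inv! 0 * inv! c) (trans (Hcoef≡H 0 (ev c) a) (H₀ₙ (ev c) a))) (sym (expS-Y-coeff₀ a c))

LHS3₀ : LHS3 ≈₀ 1ˢ
LHS3₀ = agree₀ λ where
  zero    zero    → refl
  (suc a) zero    → refl
  zero    (suc c) → refl
  (suc a) (suc c) → refl

RHS1₀ : RHS1 ≈₀ expS Y
RHS1₀ = begin
  RHS1                  ≈⟨ ≋⇒≈₀ RHS1≋ ⟩
  expS (X ⊛ P₁ ⊕ Y)     ≈⟨ subst-cong₀ inv! (X⊛F⊕G≈₀G P₁ Y) ⟩
  expS Y                ∎
  where
  open ≈₀-Reasoning

RHS2₀ : RHS2 ≈₀ expS Y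
RHS2₀ = begin
  RHS2                                      ≈⟨ ≋⇒≈₀ RHS2≋ ⟩
  S₂ ⊛ expS ((X ⊛ N₂ ⊕ Y) ⊛ A₂)             ≈⟨ ⊛-cong₀ (subst-cong₀ (gbinom α₂) (≈₀-trans (≋⇒≈₀ -ˢ[X⊛K₂]≋X⊛-ˢK₂) (X⊛≈₀0ˢ (-ˢ K₂))))
                                                       (subst-cong₀ inv! (⊛-cong₀ (X⊛F⊕G≈₀G N₂ Y) (subst-cong₀ (λ _ → 1ℚ) (X⊛≈₀0ˢ K₂)))) ⟩
  pow1p α₂ 0ˢ ⊛ expS (Y ⊛ inv1m 0ˢ)         ≈⟨ ≋⇒≈₀ (⊛-cong (subst-0ˢ (gbinom α₂)) (expS-cong (⊛-congˡ Y (subst-0ˢ (λ _ → 1ℚ))))) ⟩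
  (1ℚ · 1ˢ) ⊛ expS (Y ⊛ (1ℚ · 1ˢ))          ≈⟨ ≋⇒≈₀ (⊛-cong (·-identityˡ 1ˢ) (expS-cong (⊛-congˡ Y (·-identityˡ 1ˢ)))) ⟩
  1ˢ ⊛ expS (Y ⊛ 1ˢ)                        ≈⟨ ≋⇒≈₀ (≋-trans (⊛-identityˡ (expS (Y ⊛ 1ˢ))) (expS-cong (⊛-identityʳ Y))) ⟩
  expS Y                                    ∎
  where
  open ≈₀-Reasoning
  -ˢ[X⊛K₂]≋X⊛-ˢK₂ : -ˢ (X ⊛ K₂) ≋ X ⊛ -ˢ K₂
  -ˢ[X⊛K₂]≋X⊛-ˢK₂ = solve 2 (λ x k → :- (x :* k) := x :* (:- k)) ≋-refl X K₂
    where
    open ˢ-Solver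

RHS3₀ : RHS3 ≈₀ 1ˢ
RHS3₀ = begin
  RHS3                                ≈⟨ ≋⇒≈₀ RHS3≋ ⟩
  A₃ ⊛ expS (X ⊛ A₃)                  ≈⟨ ⊛-cong₀ (subst-cong₀ (λ _ → 1ℚ) (X⊛≈₀0ˢ U)) (subst-cong₀ inv! (X⊛≈₀0ˢ A₃)) ⟩
  inv1m 0ˢ ⊛ expS 0ˢ                  ≈⟨ ≋⇒≈₀ (⊛-cong (subst-0ˢ (λ _ → 1ℚ)) (subst-0ˢ inv!)) ⟩
  (1ℚ · 1ˢ) ⊛ (1ℚ · 1ˢ)               ≈⟨ ≋⇒≈₀ (≋-trans (⊛-cong (·-identityˡ 1ˢ) (·-identityˡ 1ˢ)) (⊛-identityˡ 1ˢ)) ⟩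
  1ˢ                                  ∎
  where
  open ≈₀-Reasoning

identity₁ : LHS1 ≋ RHS1
identity₁ = SolvesODE-unique
  (SolvesODE-cong ≋-refl (≋-sym LHS1≋Hegf) Hegf-ev-id-ode)
  (SolvesODE-cong ≋-refl (≋-sym RHS1≋) expS[X⊛P₁⊕Y]-ode)
  (≈₀-trans LHS1₀ (≈₀-sym RHS1₀))

identity₂ : LHS2 ≋ RHS2
identity₂ = SolvesODE-unique
  (SolvesODE-cong ≋-refl (≋-sym LHS2≋Hegf) Hegf-ev-ev-ode)
  (SolvesODE-cong ≋-refl (≋-sym RHS2≋) S₂⊛expS-ode)
  (≈₀-trans LHS2₀ (≈₀-sym RHS2₀))

identity₃ : LHS3 ≋ RHS3
identity₃ = SolvesODE-unique
  (SolvesODE-cong ≋-refl (≋-sym LHS3≋egf) Hdiag-ode)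
  (SolvesODE-cong ≋-refl (≋-sym RHS3≋) A₃⊛expS-ode)
  (≈₀-trans LHS3₀ (≈₀-sym RHS3₀))

theorem5p4 : (LHS1 ≋ RHS1) × (LHS2 ≋ RHS2) × (LHS3 ≋ RHS3)
theorem5p4 = identity₁ , identity₂ , identity₃
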